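{- Let $V$ be an $n$-dimensional vector space over $\mathbb{F}_q$, $2\le k\le n/2$, let $\mathcal{F}$ be a family of $k$-dimensional subspaces of $V$, and let $A, B \in \mathcal{F}$ (with $i_A,\mathcal{I}_A,\phi_A,\mathcal{F}^\star$ defined relative to this $A$ as in the context). Then: (a) If $B \notin \mathcal{F}^\star$ and $C \in \mathcal{I}_A(B)$, then $\dim(B\cap C) = i_A(B)$. (b) If $B \notin \mathcal{F}^\star$, then $D \in \phi_A(B)$ if and only if there exists $C \in \mathcal{I}_A(B)$ with $C \cap D = \{0\}$ and $B = D \oplus (B \cap C)$. In particular, if $D \in \phi_A(B)$ and $\mathcal{I}_A(B) = \{A\}$, then $B = D \oplus (B\cap A)$. (c) If $B \cap A = \{0\}$ and $B \cap C \ne \{0\}$ for some $C\in\mathcal{F}$, then $\dim(B\cap C) \ge i_A(B)$. If additionally $D \in \phi_A(B)$ and $C\cap D = \{0\}$, then $B = D\oplus(B\cap C)$. (d) If $B \notin \mathcal{F}^\star$ and $i = i_A(B)$, then $|\phi_A(B)| \ge q^{i(k-i)}$, with equality only if $C\cap B = C'\cap B$ for all $C, C' \in \mathcal{I}_A(B)$. (e) If $B \in \mathcal{F}^\star$ and $1 \le i < k$, then the number of $i$-dimensional subspaces in $\phi_A(B)$ is $\begin{bmatrix} k \\ i\end{bmatrix}_q > q^{i(k-i)}$.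
   Context: Let $\mathcal{F}$ be a family of $k$-dimensional subspaces of $V$. Let $\mathcal{F}^\star$ be the set of members of $\mathcal{F}$ whose intersection with every other member of $\mathcal{F}$ is $\{0\}$. Fix $A\in\mathcal{F}$. For $B \in \mathcal{F}\setminus\mathcal{F}^\star$ define $i_A(B) = \dim(A\cap B)$ if $A\cap B\ne\{0\}$, and $i_A(B) = \min\{\dim(B\cap C) : C\in\mathcal{F},\ B\cap C\ne\{0\}\}$ if $A\cap B=\{0\}$. Define $\mathcal{I}_A(B) = \{A\}$ if $A\cap B\ne\{0\}$, and $\mathcal{I}_A(B)=\{C\in\mathcal{F} : \dim(B\cap C) = i_A(B)\}$ if $A\cap B=\{0\}$. For $B\in\mathcal{F}$ define $\phi_A(B)$ as follows: if $B\notin\mathcal{F}^\star$, $\phi_A(B)$ is the set of $(k-i_A(B))$-dimensional subspaces $D$ of $B$ for which there exists $C\in\mathcal{I}_A(B)$ with $D\cap C=\{0\}$; if $B\in\mathcal{F}^\star$, $\phi_A(B)$ is the set of all subspaces of $B$. $\begin{bmatrix} k \\ i\end{bmatrix}_q$ denotes the Gaussian binomial coefficient (number of $i$-dimensional subspaces of a $k$-dimensional space over $\mathbb{F}_q$). -}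

module Defs where

open import Level using (0ℓ)
open import Data.Nat using (ℕ; zero; suc; _^_; _∸_; _≤_)
import Data.Nat as N
open import Data.Fin using (Fin)
open import Data.Bool using (Bool)
open import Data.List using (List; length)
open import Data.List.Membership.Propositional using (_∈_)
open import Data.List.Relation.Unary.All using (All)
open import Data.List.Relation.Unary.Any using (Any)
open import Data.List.Relation.Unary.AllPairs using (AllPairs)
open import Data.List.Relation.Unary.Unique.Propositional using (Unique)
open import Data.Vec using (Vec; replicate; zipWith; map)
open import Data.Product using (Σ; ∃; ∃-syntax; _×_; _,_)
open import Data.Sum using (_⊎_)
open import Relation.Nullary using (¬_; Dec)
open import Relation.Binary.PropositionalEquality using (_≡_; _≢_)
open import Relation.Binary.Definitions using (DecidableEquality)
open import Algebra.Core using (Op₁; Op₂)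
open import Algebra.Structures using (IsCommutativeRing)

record FiniteField : Set₁ where
  field
    Carrier : Set
    _+_ _*_ : Op₂ Carrier
    -_      : Op₁ Carrier
    0# 1#   : Carrier
    isCommutativeRing : IsCommutativeRing _≡_ _+_ _*_ -_ 0# 1#
    0≢1      : 0# ≢ 1#
    inverse  : ∀ x → x ≢ 0# → ∃[ y ] (x * y ≡ 1#)
    _≟_      : DecidableEquality Carrier
    elements : List Carrier
    complete : ∀ x → x ∈ elements
    distinct : Unique elements

  size : ℕ
  size = length elements

gauss : ℕ → ℕ → ℕ → ℕ
gauss q zero    zero    = 1
gauss q zero    (suc i) = 0
gauss q (suc k) zero    = 1
gauss q (suc k) (suc i) = gauss q k i N.+ q ^ (suc i) N.* gauss q k (suc i)

module Space (𝔽 : FiniteField) (n : ℕ) where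
  open FiniteField 𝔽 renaming (_+_ to _+F_; _*_ to _*F_)

  V : Set
  V = Vec Carrier n

  0v : V
  0v = replicate n 0#

  _+v_ : V → V → V
  _+v_ = zipWith _+F_

  _·_ : Carrier → V → V
  a · v = map (a *F_) v

  record Subspace : Set₁ where
    field
      _∋_     : V → Set
      dec      : ∀ v → Dec (_∋_ v)
      0∈       : _∋_ 0v
      +-closed : ∀ u v → _∋_ u → _∋_ v → _∋_ (u +v v)
      ·-closed : ∀ a v → _∋_ v → _∋_ (a · v)
  open Subspace public

  _≈_ : Subspace → Subspace → Set
  W ≈ U = ∀ v → (W ∋ v → U ∋ v) × (U ∋ v → W ∋ v)

  _⊆_ : Subspace → Subspace → Set
  W ⊆ U = ∀ v → W ∋ v → U ∋ v

  _∩_ : Subspace → Subspace → Subspace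
  W ∩ U = record
    { _∋_ = λ v → (W ∋ v) × (U ∋ v)
    ; dec = λ v → decPair (dec W v) (dec U v)
    ; 0∈ = 0∈ W , 0∈ U
    ; +-closed = λ { u v (p , p') (r , r') → +-closed W u v p r , +-closed U u v p' r' }
    ; ·-closed = λ { a v (p , p') → ·-closed W a v p , ·-closed U a v p' }
    }
    where
    open import Relation.Nullary.Decidable using (_×-dec_)
    decPair : ∀ {P Q : Set} → Dec P → Dec Q → Dec (P × Q)
    decPair = _×-dec_

  Trivial : Subspace → Set
  Trivial W = ∀ v → W ∋ v → v ≡ 0v

  lincomb : ∀ {d} → (Fin d → Carrier) → (Fin d → V) → V
  lincomb {zero}  c b = 0v
  lincomb {suc d} c b = (c Fin.zero · b Fin.zero) +v lincomb (λ j → c (Fin.suc j)) (λ j → b (Fin.suc j))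
    where import Data.Fin as Fin

  Dim : Subspace → ℕ → Set
  Dim W d = Σ (Fin d → V) λ b →
              (∀ j → W ∋ b j)
            × (∀ c → lincomb c b ≡ 0v → ∀ j → c j ≡ 0#)
            × (∀ v → W ∋ v → ∃[ c ] (v ≡ lincomb c b))

  DirectSum : Subspace → Subspace → Subspace → Set
  DirectSum B D E =
      (∀ v → (B ∋ v → ∃[ d ] ∃[ e ] (D ∋ d × E ∋ e × v ≡ d +v e))
           × (∃[ d ] ∃[ e ] (D ∋ d × E ∋ e × v ≡ d +v e) → B ∋ v))
    × Trivial (D ∩ E)

  Family : Set₁
  Family = List Subspace

  _∈F_ : Subspace → Family → Set₁
  C ∈F 𝓕 = Any (C ≈_) 𝓕

  Star : Family → Subspace → Set₁
  Star 𝓕 B = ∀ C → C ∈F 𝓕 → ¬ (C ≈ B) → Trivial (B ∩ C)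

  -- i_A(B) = i  (relational form of the function i_A)
  IsI : Family → Subspace → Subspace → ℕ → Set₁
  IsI 𝓕 A B i =
      (¬ Trivial (A ∩ B) × Lift1 (Dim (A ∩ B) i))
    ⊎ (Trivial (A ∩ B)
       × (∃[ C ] (C ∈F 𝓕 × Lift1 (¬ Trivial (B ∩ C)) × Lift1 (Dim (B ∩ C) i)))
       × (∀ C → C ∈F 𝓕 → ¬ Trivial (B ∩ C) → ∀ d → Dim (B ∩ C) d → i ≤ d))
    where
    open import Level using (Lift)
    Lift1 : Set → Set₁
    Lift1 X = Lift _ X

  InI : Family → Subspace → Subspace → Subspace → Set₁
  InI 𝓕 A B C =
      (¬ Trivial (A ∩ B) × Lift1 (C ≈ A))
    ⊎ (Trivial (A ∩ B) × C ∈F 𝓕 × ∃[ i ] (IsI 𝓕 A B i × Lift1 (Dim (B ∩ C) i)))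
    where
    open import Level using (Lift)
    Lift1 : Set → Set₁
    Lift1 X = Lift _ X

  -- D ∈ φ_A(B)   (k = common dimension of the members of 𝓕)
  Phi : ℕ → Family → Subspace → Subspace → Subspace → Set₁
  Phi k 𝓕 A B D =
      (¬ Star 𝓕 B × Lift1 (D ⊆ B)
       × ∃[ i ] (IsI 𝓕 A B i × Lift1 (Dim D (k ∸ i))
                 × ∃[ C ] (InI 𝓕 A B C × Lift1 (Trivial (D ∩ C)))))
    ⊎ (Star 𝓕 B × Lift1 (D ⊆ B))
    where
    open import Level using (Lift)
    Lift1 : Set → Set₁
    Lift1 X = Lift _ X

  Card : (Subspace → Set₁) → ℕ → Set₁
  Card P m = Σ (List Subspace) λ L →
      All P L
    × (∀ S → P S → Any (S ≈_) L)
    × AllPairs (λ S T → ¬ (S ≈ T)) L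
    × length L ≡ m

{-# OPTIONS --safe #-}
-- Everything is reduced to counting vectors of V = F_q^n. If the tuple b is independent modulo a subspace W,
-- then W + ⟨b⟩ has ∣W∣ q^|b| elements; hence ∣W∣ = q^(dim W), dimensions are read off from cardinalities, and
-- an inclusion between subspaces of the same dimension is an equality. Counting the (k−i)-tuples of a
-- k-dimensional B that are independent modulo an i-dimensional W ⊆ B once directly and once through the
-- subspaces D they span (exactly those with D ∩ W = 0) shows that W has q^(i(k−i)) complements in B; for W = 0
-- it shows that B has [k i]_q subspaces of dimension i, which is (e). For (d), every complement of B ∩ C (C ∈ 𝓘_A(B)) lies in φ_A(B), and if
-- B ∩ C ≠ B ∩ C′, a vector of (B ∩ C) ∖ (B ∩ C′) extends to a complement of B ∩ C′ in φ_A(B) that is not a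
-- complement of B ∩ C.
module Submission where

open import Defs
open import Level using (Level; 0ℓ; Lift; lift) renaming (suc to lsuc)
open import Function using (_∘_; id; case_of_)
open import Data.Nat using (ℕ; zero; suc; _≤_; _<_; _*_; _^_; _∸_; _+_; z≤n; s≤s; NonZero; >-nonZero; _≟_; _≤?_)
open import Data.Nat.Properties
open import Data.Nat.Tactic.RingSolver using (solve-∀)
open import Data.Unit using (⊤; tt)
open import Data.Sum using (_⊎_; inj₁; inj₂)
open import Data.Product using (Σ; ∃; ∃-syntax; _×_; _,_; proj₁; proj₂)
open import Data.Fin using (Fin)
import Data.Fin as Fin
open import Data.Vec using (Vec; []; _∷_; _++_; zipWith; replicate; map; tabulate; lookup)
open import Data.Vec.Properties
  using (zipWith-assoc; zipWith-comm; zipWith-identityˡ; zipWith-identityʳ; zipWith-inverseˡ; zipWith-inverseʳ;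
         map-cong; map-∘; map-id; map-const; map-replicate)
import Data.Vec.Properties as Vecₚ
import Data.Vec.Relation.Unary.All as VecAll
import Data.Vec.Relation.Unary.All.Properties as VecAllₚ
open import Data.List using (List; []; _∷_; length; filter; deduplicate; cartesianProductWith; cartesianProduct)
import Data.List as List
open import Data.List.Properties
  using (length-++; length-map; filter-++; filter-≐; filter-all; filter-none; length-filter; length-removeAt′)
open import Data.List.Membership.Propositional using (_∈_; find)
open import Data.List.Membership.Propositional.Properties
  using (∈-filter⁺; ∈-filter⁻; ∈-map⁺; ∈-cartesianProductWith⁺; ∈-cartesianProduct⁺)
open import Data.List.Relation.Unary.Any using (Any; here; there; _─_; index; any?)
import Data.List.Relation.Unary.Any as Any
import Data.List.Relation.Unary.Any.Properties as Anyₚ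
open import Data.List.Relation.Unary.All using (All; all?)
import Data.List.Relation.Unary.All as All
import Data.List.Relation.Unary.All.Properties as Allₚ
open import Data.List.Relation.Unary.AllPairs using (AllPairs)
import Data.List.Relation.Unary.AllPairs as AllPairs
import Data.List.Relation.Unary.AllPairs.Properties as AllPairsₚ
open import Data.List.Relation.Unary.Unique.Propositional using (Unique)
import Data.List.Relation.Unary.Unique.Propositional.Properties as Unique
open import Data.List.Relation.Unary.Unique.DecSetoid.Properties using (deduplicate-!)
open import Relation.Nullary using (¬_; Dec; yes; no; contradiction)
open import Relation.Nullary.Decidable using (_×-dec_; _→-dec_; ¬?; decidable-stable)
open import Relation.Unary using (Pred; Decidable; _≐_; ∁)
open import Relation.Unary.Properties using (_∩?_; ∁?)
open import Relation.Binary.Bundles using (DecSetoid)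
import Relation.Binary.Reasoning.Setoid as SetoidReasoning
open import Relation.Binary.PropositionalEquality
  using (_≡_; _≢_; refl; sym; trans; cong; cong₂; subst; subst₂; isMagma; module ≡-Reasoning)
open import Algebra.Bundles using (CommutativeRing; AbelianGroup)
open import Algebra.Structures using (IsCommutativeRing)
import Algebra.Properties.AbelianGroup as AbelianGroupProperties
import Algebra.Properties.CommutativeSemigroup as CommutativeSemigroupProperties
import Algebra.Properties.Ring as RingProperties

private variable
  ℓ p : Level
  X Y Z : Set ℓ

-- Counting in lists

count : {P : Pred X p} → Decidable P → List X → ℕ
count P? xs = length (filter P? xs)

module _ {P : Pred X p} (P? : Decidable P) where

  count-all : ∀ {xs} → All P xs → count P? xs ≡ length xs
  count-all all = cong length (filter-all P? all)

  count-none : ∀ {xs} → All (∁ P) xs → count P? xs ≡ 0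
  count-none none = cong length (filter-none P? none)

  count-++ : ∀ xs ys → count P? (xs List.++ ys) ≡ count P? xs + count P? ys
  count-++ xs ys = trans (cong length (filter-++ P? xs ys)) (length-++ (filter P? xs))

  count-map : ∀ (g : Y → X) ys → count P? (List.map g ys) ≡ count (P? ∘ g) ys
  count-map g []       = refl
  count-map g (y ∷ ys) with P? (g y)
  ... | yes _ = cong suc (count-map g ys)
  ... | no _  = count-map g ys

module _ {P : Pred X p} {Q : Pred X p} (P? : Decidable P) (Q? : Decidable Q) where

  count-≐ : P ≐ Q → ∀ xs → count P? xs ≡ count Q? xs
  count-≐ P≐Q xs = cong length (filter-≐ P? Q? P≐Q xs)

  count-split : ∀ xs → count P? xs ≡ count (P? ∩? Q?) xs + count (P? ∩? ∁? Q?) xs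
  count-split []       = refl
  count-split (x ∷ xs) with P? x | Q? x
  ... | yes _ | yes _ = cong suc (count-split xs)
  ... | yes _ | no _  = trans (cong suc (count-split xs)) (sym (+-suc _ _))
  ... | no _  | _     = count-split xs

module _ {q} {P : Pred X p} {Q : Pred X q} (P? : Decidable P) (Q? : Decidable Q) where

  count-mono : ∀ {xs} → All (λ x → P x → Q x) xs → count P? xs ≤ count Q? xs
  count-mono {[]}     All.[]              = z≤n
  count-mono {x ∷ xs} (P⇒Q All.∷ P⇒Qs) with P? x | Q? x
  ... | yes px | no ¬qx = contradiction (P⇒Q px) ¬qx
  ... | yes _  | yes _  = s≤s (count-mono P⇒Qs)
  ... | no _   | yes _  = m≤n⇒m≤1+n (count-mono P⇒Qs)
  ... | no _   | no _   = count-mono P⇒Qs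

  count-strict : ∀ {xs y} → All (λ x → P x → Q x) xs → y ∈ xs → Q y → ¬ P y → count P? xs < count Q? xs
  count-strict {x ∷ xs} (P⇒Q All.∷ P⇒Qs) (here refl) qx ¬px with P? x | Q? x
  ... | yes px | _      = contradiction px ¬px
  ... | no _   | no ¬qx = contradiction qx ¬qx
  ... | no _   | yes _  = s≤s (count-mono P⇒Qs)
  count-strict {x ∷ xs} (P⇒Q All.∷ P⇒Qs) (there y∈xs) qy ¬py with P? x | Q? x
  ... | yes px | no ¬qx = contradiction (P⇒Q px) ¬qx
  ... | yes _  | yes _  = s≤s (count-strict P⇒Qs y∈xs qy ¬py)
  ... | no _   | yes _  = m≤n⇒m≤1+n (count-strict P⇒Qs y∈xs qy ¬py)
  ... | no _   | no _   = count-strict P⇒Qs y∈xs qy ¬py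

private
  ∈-─ : ∀ {x y : X} {ys} (x∈ys : x ∈ ys) → y ∈ ys → y ≢ x → y ∈ (ys ─ x∈ys)
  ∈-─ (here refl)  (here refl)  y≢x = contradiction refl y≢x
  ∈-─ (here refl)  (there y∈ys) _   = y∈ys
  ∈-─ (there x∈ys) (here refl)  _   = here refl
  ∈-─ (there x∈ys) (there y∈ys) y≢x = there (∈-─ x∈ys y∈ys y≢x)

injection⇒length≤ : (f : X → Y) {xs : List X} {ys : List Y} → Unique xs →
                    (∀ {x x′} → x ∈ xs → x′ ∈ xs → f x ≡ f x′ → x ≡ x′) →
                    (∀ {x} → x ∈ xs → f x ∈ ys) → length xs ≤ length ys
injection⇒length≤ f {[]}     _                   _   _    = z≤n
injection⇒length≤ f {x ∷ xs} {ys} (x∉xs AllPairs.∷ xs!) inj into =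
  subst (suc (length xs) ≤_) (sym (length-removeAt′ ys (index fx∈ys)))
    (s≤s (injection⇒length≤ f xs! (λ p p′ → inj (there p) (there p′)) into′))
  where
  fx∈ys : f x ∈ ys
  fx∈ys = into (here refl)
  into′ : ∀ {y} → y ∈ xs → f y ∈ (ys ─ fx∈ys)
  into′ y∈xs = ∈-─ fx∈ys (into (there y∈xs))
    (λ fy≡fx → All.lookup x∉xs y∈xs (inj (here refl) (there y∈xs) (sym fy≡fx)))

module _ {q} {P : Pred X p} {Q : Pred Y q} (P? : Decidable P) (Q? : Decidable Q)
         {xs : List X} {ys : List Y} (xs! : Unique xs) (ys! : Unique ys)
         (xs-complete : ∀ x → x ∈ xs) (ys-complete : ∀ y → y ∈ ys) (f : X → Y) where

  count-bijection : (∀ {x x′} → P x → P x′ → f x ≡ f x′ → x ≡ x′) → (∀ {x} → P x → Q (f x)) →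
                    (∀ {y} → Q y → ∃[ x ] P x × f x ≡ y) → count P? xs ≡ count Q? ys
  count-bijection inj P⇒Q Q⇒P = ≤-antisym
    (injection⇒length≤ f (Unique.filter⁺ P? xs!) (λ p p′ → inj (filtered p) (filtered p′))
      (λ p → ∈-filter⁺ Q? (ys-complete _) (P⇒Q (filtered p))))
    (subst (count Q? ys ≤_) (length-map f (filter P? xs))
      (injection⇒length≤ id (Unique.filter⁺ Q? ys!) (λ _ _ e → e) into))
    where
    filtered : ∀ {x} → x ∈ filter P? xs → P x
    filtered = proj₂ ∘ ∈-filter⁻ P? {xs = xs}
    into : ∀ {y} → y ∈ filter Q? ys → y ∈ List.map f (filter P? xs)
    into y∈ with Q⇒P (proj₂ (∈-filter⁻ Q? {xs = ys} y∈))
    ... | x , px , refl = ∈-map⁺ f (∈-filter⁺ P? (xs-complete x) px)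

module _ {r} (h : X → Y → Z) {R : Pred Z r} (R? : Decidable R) {P : Pred X p} (P? : Decidable P)
         (K : ℕ) (ys : List Y) where

  count-cartesianProductWith : (∀ {x} → P x → count (R? ∘ h x) ys ≡ K) → (∀ {x y} → R (h x y) → P x) →
                               ∀ xs → count R? (cartesianProductWith h xs ys) ≡ count P? xs * K
  count-cartesianProductWith rows R⇒P []       = refl
  count-cartesianProductWith rows R⇒P (x ∷ xs) with P? x
  ... | yes px = trans (count-++ R? (List.map (h x) ys) _)
    (cong₂ _+_ (trans (count-map R? (h x) ys) (rows px)) (count-cartesianProductWith rows R⇒P xs))
  ... | no ¬px = trans (count-++ R? (List.map (h x) ys) _)
    (cong₂ _+_ (trans (count-map R? (h x) ys) (count-none (R? ∘ h x) {xs = ys} (All.tabulate (λ _ → ¬px ∘ R⇒P))))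
               (count-cartesianProductWith rows R⇒P xs))

length-cartesianProductWith : (h : X → Y → Z) (xs : List X) (ys : List Y) →
                              length (cartesianProductWith h xs ys) ≡ length xs * length ys
length-cartesianProductWith h []       ys = refl
length-cartesianProductWith h (x ∷ xs) ys = trans (length-++ (List.map (h x) ys))
  (cong₂ _+_ (length-map (h x) ys) (length-cartesianProductWith h xs ys))

Any-filter⁺ : ∀ {q} {P : Pred X p} {Q : Pred X q} (Q? : Decidable Q) → (∀ {x} → P x → Q x) →
              ∀ {xs} → Any P xs → Any P (filter Q? xs)
Any-filter⁺ Q? P⇒Q p with Anyₚ.filter⁺ Q? p
... | inj₁ p′ = p′
... | inj₂ ¬q = contradiction (P⇒Q (Anyₚ.lookup-result p)) ¬q

record Enumeration (X : Set ℓ) : Set ℓ where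
  constructor enumeration
  field
    list     : List X
    unique   : Unique list
    complete : ∀ x → x ∈ list
open Enumeration public

module _ (E : Enumeration X) {P : Pred X p} (P? : Decidable P) where

  ∃? : Dec (∃ P)
  ∃? with any? P? (list E)
  ... | yes some = yes (Any.satisfied some)
  ... | no none  = no λ { (x , px) → none (Any.map (λ { refl → px }) (complete E x)) }

  ∀? : Dec (∀ x → P x)
  ∀? with all? P? (list E)
  ... | yes all = yes λ x → All.lookup all (complete E x)
  ... | no ¬all = no λ f → ¬all (All.tabulate (λ {x} _ → f x))

⊆-or-counterexample : ∀ {q} (E : Enumeration X) {P : Pred X p} {Q : Pred X q} → Decidable P → Decidable Q →
                      (∀ x → P x → Q x) ⊎ ∃[ x ] (P x × ¬ Q x)
⊆-or-counterexample E P? Q? with ∃? E (λ x → P? x ×-dec ¬? (Q? x))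
... | yes counterexample = inj₂ counterexample
... | no none            = inj₁ λ x px → decidable-stable (Q? x) (λ ¬qx → none (x , px , ¬qx))

vecEnumeration : Enumeration X → ∀ d → Enumeration (Vec X d)
vecEnumeration E zero    = enumeration ([] ∷ []) (All.[] AllPairs.∷ AllPairs.[]) λ { [] → here refl }
vecEnumeration E (suc d) = enumeration
  (cartesianProductWith cons (list (vecEnumeration E d)) (list E))
  (Unique.cartesianProductWith⁺ cons (λ { refl → refl , refl }) (unique (vecEnumeration E d)) (unique E))
  (λ { (x ∷ xs) → ∈-cartesianProductWith⁺ cons (complete (vecEnumeration E d) xs) (complete E x) })
  where
  cons : Vec _ d → _ → Vec _ (suc d)
  cons xs x = x ∷ xs

length-vecEnumeration : (E : Enumeration X) → ∀ d → length (list (vecEnumeration E d)) ≡ length (list E) ^ d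
length-vecEnumeration E zero    = refl
length-vecEnumeration E (suc d) = trans (length-cartesianProductWith _ (list (vecEnumeration E d)) (list E))
  (trans (cong (_* length (list E)) (length-vecEnumeration E d)) (*-comm _ (length (list E))))

×-enumeration : Enumeration X → Enumeration Y → Enumeration (X × Y)
×-enumeration E₁ E₂ = enumeration (cartesianProduct (list E₁) (list E₂))
  (Unique.cartesianProduct⁺ (unique E₁) (unique E₂))
  (λ { (x , y) → ∈-cartesianProduct⁺ (complete E₁ x) (complete E₂ y) })

-- q-falling products and Gaussian binomials

module QArithmetic (q : ℕ) (1<q : 1 < q) where

  instance
    q-nonZero : NonZero q
    q-nonZero = >-nonZero (<-trans (s≤s z≤n) 1<q)

  ^-reflects-≤ : ∀ {a b} → q ^ a ≤ q ^ b → a ≤ b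
  ^-reflects-≤ {a} {b} q^a≤q^b with a ≤? b
  ... | yes a≤b = a≤b
  ... | no a≰b  = contradiction q^a≤q^b (<⇒≱ (^-monoʳ-< q 1<q (≰⇒> a≰b)))

  ^-injective : ∀ {a b} → q ^ a ≡ q ^ b → a ≡ b
  ^-injective e = ≤-antisym (^-reflects-≤ (≤-reflexive e)) (^-reflects-≤ (≤-reflexive (sym e)))

  qFalling : ℕ → ℕ → ℕ → ℕ
  qFalling K w zero    = 1
  qFalling K w (suc j) = qFalling K w j * (K ∸ w * q ^ j)

  private
    F : ℕ → ℕ → ℕ
    F m j = qFalling (q ^ m) 1 j

    F-suc : ∀ m j → F m (suc j) ≡ F m j * (q ^ m ∸ q ^ j)
    F-suc m j = cong (λ t → F m j * (q ^ m ∸ t)) (*-identityˡ (q ^ j))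

    -- q^(k+1) − q^(t+1) = q (q^k − q^t): every factor but the first carries a q.
    F-suc-suc : ∀ k j → F (suc k) (suc j) ≡ (q ^ suc k ∸ 1) * q ^ j * F k j
    F-suc-suc k zero    = trans (*-identityˡ _) (sym (trans (*-identityʳ _) (*-identityʳ _)))
    F-suc-suc k (suc j) = begin
      F (suc k) (suc (suc j))
        ≡⟨ F-suc (suc k) (suc j) ⟩
      F (suc k) (suc j) * (q ^ suc k ∸ q ^ suc j)
        ≡⟨ cong₂ _*_ (F-suc-suc k j) (sym (*-distribˡ-∸ q (q ^ k) (q ^ j))) ⟩
      (q ^ suc k ∸ 1) * q ^ j * F k j * (q * (q ^ k ∸ q ^ j))
        ≡⟨ regroup (q ^ suc k ∸ 1) (q ^ j) (F k j) q (q ^ k ∸ q ^ j) ⟩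
      (q ^ suc k ∸ 1) * (q * q ^ j) * (F k j * (q ^ k ∸ q ^ j))
        ≡⟨ cong ((q ^ suc k ∸ 1) * (q * q ^ j) *_) (sym (F-suc k j)) ⟩
      (q ^ suc k ∸ 1) * q ^ suc j * F k (suc j) ∎
      where
      open ≡-Reasoning
      regroup : ∀ a b c x d → a * b * c * (x * d) ≡ a * (x * b) * (c * d)
      regroup = solve-∀

    F-vanishes : ∀ k i → k < i → F k i ≡ 0
    F-vanishes k (suc i) (s≤s k≤i) with k ≟ i
    ... | yes refl = trans (F-suc k k) (trans (cong (F k k *_) (n∸n≡0 (q ^ k))) (*-zeroʳ (F k k)))
    ... | no k≢i   = cong (_* (q ^ k ∸ 1 * q ^ i)) (F-vanishes k i (≤∧≢⇒< k≤i k≢i))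

    q^-split : ∀ i k → i ≤ k → (q ^ suc i ∸ 1) + q * (q ^ k ∸ q ^ i) ≡ q ^ suc k ∸ 1
    q^-split i k i≤k = begin
      (q ^ suc i ∸ 1) + q * (q ^ k ∸ q ^ i)          ≡⟨ cong (q ^ suc i ∸ 1 +_) (*-distribˡ-∸ q (q ^ k) (q ^ i)) ⟩
      (q ^ suc i ∸ 1) + (q ^ suc k ∸ q ^ suc i)      ≡⟨ +-comm (q ^ suc i ∸ 1) _ ⟩
      (q ^ suc k ∸ q ^ suc i) + (q ^ suc i ∸ 1)      ≡⟨ +-∸-assoc (q ^ suc k ∸ q ^ suc i) (m^n>0 q (suc i)) ⟨
      (q ^ suc k ∸ q ^ suc i) + q ^ suc i ∸ 1        ≡⟨ cong (_∸ 1) (m∸n+n≡m (^-monoʳ-≤ q (s≤s i≤k))) ⟩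
      q ^ suc k ∸ 1                                  ∎
      where open ≡-Reasoning

  -- Split the factor q^(k+1) − 1 of the left-hand side as (q^(i+1) − 1) + q (q^k − q^i) and use the
  -- q-Pascal recurrence of gauss.
  qFalling-gauss : ∀ k i → qFalling (q ^ k) 1 i ≡ gauss q k i * qFalling (q ^ i) 1 i
  qFalling-gauss zero    zero    = refl
  qFalling-gauss zero    (suc i) = trans (F-suc 0 i) (trans (cong (F 0 i *_) (m≤n⇒m∸n≡0 (m^n>0 q i))) (*-zeroʳ (F 0 i)))
  qFalling-gauss (suc k) zero    = refl
  qFalling-gauss (suc k) (suc i) = begin
    F (suc k) (suc i)                                                           ≡⟨ F-suc-suc k i ⟩
    (q ^ suc k ∸ 1) * q ^ i * F k i                                             ≡⟨ split-first-factor ⟩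
    (q ^ suc i ∸ 1) * q ^ i * F k i + q * q ^ i * (F k i * (q ^ k ∸ q ^ i))     ≡⟨ cong₂ _+_ first second ⟩
    gauss q k i * F (suc i) (suc i) + q ^ suc i * gauss q k (suc i) * F (suc i) (suc i)
      ≡⟨ *-distribʳ-+ (F (suc i) (suc i)) (gauss q k i) _ ⟨
    gauss q (suc k) (suc i) * F (suc i) (suc i)                                 ∎
    where
    open ≡-Reasoning
    split-first-factor : (q ^ suc k ∸ 1) * q ^ i * F k i ≡
                         (q ^ suc i ∸ 1) * q ^ i * F k i + q * q ^ i * (F k i * (q ^ k ∸ q ^ i))
    split-first-factor with i ≤? k
    ... | yes i≤k = trans (cong (λ t → t * q ^ i * F k i) (sym (q^-split i k i≤k)))
                          (distrib (q ^ suc i ∸ 1) q (q ^ k ∸ q ^ i) (q ^ i) (F k i))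
      where
      distrib : ∀ a x d y z → (a + x * d) * y * z ≡ a * y * z + x * y * (z * d)
      distrib = solve-∀
    ... | no i≰k rewrite F-vanishes k i (≰⇒> i≰k) = trans (*-zeroʳ ((q ^ suc k ∸ 1) * q ^ i))
      (sym (cong₂ _+_ (*-zeroʳ ((q ^ suc i ∸ 1) * q ^ i)) (*-zeroʳ (q * q ^ i))))
    first : (q ^ suc i ∸ 1) * q ^ i * F k i ≡ gauss q k i * F (suc i) (suc i)
    first = begin
      (q ^ suc i ∸ 1) * q ^ i * F k i                   ≡⟨ cong ((q ^ suc i ∸ 1) * q ^ i *_) (qFalling-gauss k i) ⟩
      (q ^ suc i ∸ 1) * q ^ i * (gauss q k i * F i i)   ≡⟨ swap (q ^ suc i ∸ 1) (q ^ i) (gauss q k i) (F i i) ⟩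
      gauss q k i * ((q ^ suc i ∸ 1) * q ^ i * F i i)   ≡⟨ cong (gauss q k i *_) (F-suc-suc i i) ⟨
      gauss q k i * F (suc i) (suc i)                   ∎
      where
      swap : ∀ a x g y → a * x * (g * y) ≡ g * (a * x * y)
      swap = solve-∀
    second : q * q ^ i * (F k i * (q ^ k ∸ q ^ i)) ≡ q ^ suc i * gauss q k (suc i) * F (suc i) (suc i)
    second = begin
      q * q ^ i * (F k i * (q ^ k ∸ q ^ i))               ≡⟨ cong (q * q ^ i *_) (F-suc k i) ⟨
      q * q ^ i * F k (suc i)                             ≡⟨ cong (q * q ^ i *_) (qFalling-gauss k (suc i)) ⟩
      q * q ^ i * (gauss q k (suc i) * F (suc i) (suc i)) ≡⟨ *-assoc (q * q ^ i) _ _ ⟨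
      q ^ suc i * gauss q k (suc i) * F (suc i) (suc i)   ∎

  qFalling-scale : ∀ i m j → qFalling (q ^ (i + m)) (q ^ i) j ≡ q ^ (i * j) * qFalling (q ^ m) 1 j
  qFalling-scale i m zero    = cong (λ t → q ^ t * 1) (sym (*-zeroʳ i))
  qFalling-scale i m (suc j) = begin
    qFalling (q ^ (i + m)) (q ^ i) j * (q ^ (i + m) ∸ q ^ i * q ^ j)
      ≡⟨ cong₂ _*_ (qFalling-scale i m j) factor ⟩
    q ^ (i * j) * F m j * (q ^ i * (q ^ m ∸ q ^ j))
      ≡⟨ regroup (q ^ (i * j)) (F m j) (q ^ i) (q ^ m ∸ q ^ j) ⟩
    q ^ i * q ^ (i * j) * (F m j * (q ^ m ∸ q ^ j))
      ≡⟨ cong₂ _*_ (trans (sym (^-distribˡ-+-* q i (i * j))) (cong (q ^_) (sym (*-suc i j)))) (sym (F-suc m j)) ⟩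
    q ^ (i * suc j) * F m (suc j) ∎
    where
    open ≡-Reasoning
    factor : q ^ (i + m) ∸ q ^ i * q ^ j ≡ q ^ i * (q ^ m ∸ q ^ j)
    factor = trans (cong (_∸ q ^ i * q ^ j) (^-distribˡ-+-* q i m)) (sym (*-distribˡ-∸ (q ^ i) (q ^ m) (q ^ j)))
    regroup : ∀ a b c d → a * b * (c * d) ≡ c * a * (b * d)
    regroup = solve-∀

  qFalling-positive : ∀ {m} j → j ≤ m → 0 < qFalling (q ^ m) 1 j
  qFalling-positive         zero    _   = s≤s z≤n
  qFalling-positive {m = m} (suc j) j<m = subst (0 <_) (sym (F-suc m j))
    (*-mono-≤ (qFalling-positive j (<⇒≤ j<m)) (m<n⇒0<n∸m (^-monoʳ-< q 1<q j<m)))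

  gauss-lower : ∀ k i → i ≤ k → q ^ (i * (k ∸ i)) ≤ gauss q k i
  gauss-lower-step : ∀ k i → i < k → q ^ (suc i * (k ∸ i)) ≤ q ^ suc i * gauss q k (suc i)

  gauss-lower zero    zero    _ = ≤-refl
  gauss-lower (suc k) zero    _ = ≤-refl
  gauss-lower (suc k) (suc i) (s≤s i≤k) with m≤n⇒m<n∨m≡n i≤k
  ... | inj₁ i<k  = ≤-trans (gauss-lower-step k i i<k) (m≤n+m _ _)
  ... | inj₂ refl = begin
    q ^ (suc i * (i ∸ i))   ≡⟨ cong (λ t → q ^ (suc i * t)) (n∸n≡0 i) ⟩
    q ^ (suc i * 0)         ≡⟨ cong (q ^_) (*-zeroʳ (suc i)) ⟩
    1                       ≤⟨ m^n>0 q (i * (i ∸ i)) ⟩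
    q ^ (i * (i ∸ i))       ≤⟨ gauss-lower i i ≤-refl ⟩
    gauss q i i             ≤⟨ m≤m+n _ _ ⟩
    gauss q (suc i) (suc i) ∎
    where open ≤-Reasoning

  gauss-lower-step k i i<k = subst (_≤ q ^ suc i * gauss q k (suc i)) (sym exponent)
    (*-monoʳ-≤ (q ^ suc i) (gauss-lower k (suc i) i<k))
    where
    exponent : q ^ (suc i * (k ∸ i)) ≡ q ^ suc i * q ^ (suc i * (k ∸ suc i))
    exponent = trans (cong (λ t → q ^ (suc i * t)) (+-∸-assoc 1 i<k))
               (trans (cong (q ^_) (*-suc (suc i) (k ∸ suc i))) (^-distribˡ-+-* q (suc i) _))

  gauss-strict : ∀ k i → 1 ≤ i → i < k → q ^ (i * (k ∸ i)) < gauss q k i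
  gauss-strict (suc k) (suc i) _ (s≤s i<k) =
    +-mono-≤ (≤-trans (m^n>0 q (i * (k ∸ i))) (gauss-lower k i (<⇒≤ i<k))) (gauss-lower-step k i i<k)

-- Vectors over a finite field

module Vectors (𝔽 : FiniteField) where
  open FiniteField 𝔽 using (Carrier; isCommutativeRing) renaming (-_ to negate)

  private
    ring : CommutativeRing 0ℓ 0ℓ
    ring = record { isCommutativeRing = isCommutativeRing }
    module F = CommutativeRing ring
    variable
      m d : ℕ

  infixl 6 _⊕_ _⊖_
  infixr 7 _⊙_
  infix  8 ⊝_

  _⊕_ : Vec Carrier m → Vec Carrier m → Vec Carrier m
  _⊕_ = zipWith F._+_

  ⊝_ : Vec Carrier m → Vec Carrier m
  ⊝_ = map negate

  _⊖_ : Vec Carrier m → Vec Carrier m → Vec Carrier m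
  u ⊖ v = u ⊕ ⊝ v

  𝟎 : Vec Carrier m
  𝟎 = replicate _ F.0#

  _⊙_ : Carrier → Vec Carrier m → Vec Carrier m
  a ⊙ v = map (a F.*_) v

  ⊕-abelianGroup : ℕ → AbelianGroup 0ℓ 0ℓ
  ⊕-abelianGroup m = record
    { Carrier        = Vec Carrier m
    ; _≈_            = _≡_
    ; _∙_            = _⊕_
    ; ε              = 𝟎
    ; _⁻¹            = ⊝_
    ; isAbelianGroup = record
      { isGroup = record
        { isMonoid = record
          { isSemigroup = record { isMagma = isMagma _⊕_ ; assoc = zipWith-assoc F.+-assoc }
          ; identity    = zipWith-identityˡ F.+-identityˡ , zipWith-identityʳ F.+-identityʳ
          }
        ; inverse = zipWith-inverseˡ F.-‿inverseˡ , zipWith-inverseʳ F.-‿inverseʳ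
        ; ⁻¹-cong = cong ⊝_
        }
      ; comm = zipWith-comm F.+-comm
      }
    }

  module ⊕ {m} = AbelianGroup (⊕-abelianGroup m)
  module ⊕-Properties {m} = AbelianGroupProperties (⊕-abelianGroup m)
  module ⊕-Commutative {m} = CommutativeSemigroupProperties (⊕.commutativeSemigroup {m})

  ⊙-distribˡ : ∀ a (u v : Vec Carrier m) → a ⊙ (u ⊕ v) ≡ a ⊙ u ⊕ a ⊙ v
  ⊙-distribˡ a []      []      = refl
  ⊙-distribˡ a (x ∷ u) (y ∷ v) = cong₂ _∷_ (F.distribˡ a x y) (⊙-distribˡ a u v)

  ⊙-distribʳ : ∀ a b (u : Vec Carrier m) → (a F.+ b) ⊙ u ≡ a ⊙ u ⊕ b ⊙ u
  ⊙-distribʳ a b []      = refl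
  ⊙-distribʳ a b (x ∷ u) = cong₂ _∷_ (F.distribʳ x a b) (⊙-distribʳ a b u)

  ⊙-assoc : ∀ a b (u : Vec Carrier m) → (a F.* b) ⊙ u ≡ a ⊙ b ⊙ u
  ⊙-assoc a b u = trans (map-cong (F.*-assoc a b) u) (map-∘ (a F.*_) (b F.*_) u)

  ⊙-identityˡ : ∀ (u : Vec Carrier m) → F.1# ⊙ u ≡ u
  ⊙-identityˡ u = trans (map-cong F.*-identityˡ u) (map-id u)

  ⊙-zeroˡ : ∀ (u : Vec Carrier m) → F.0# ⊙ u ≡ 𝟎
  ⊙-zeroˡ u = trans (map-cong F.zeroˡ u) (map-const u F.0#)

  ⊙-zeroʳ : ∀ a → a ⊙ 𝟎 {m} ≡ 𝟎
  ⊙-zeroʳ {m} a = trans (map-replicate (a F.*_) F.0# m) (cong (replicate m) (F.zeroʳ a))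

  ⊝-as-⊙ : ∀ (u : Vec Carrier m) → ⊝ u ≡ (F.- F.1#) ⊙ u
  ⊝-as-⊙ u = map-cong (λ x → sym (RingProperties.-1*x≈-x F.ring x)) u

  ⊕-⊖-swap : ∀ {w x w′ x′ : Vec Carrier m} → w ⊕ x ≡ w′ ⊕ x′ → x ⊖ x′ ≡ w′ ⊖ w
  ⊕-⊖-swap {w = w} {x} {w′} {x′} e =
    trans (⊕-Properties.inverseʳ-unique (w ⊖ w′) (x ⊖ x′) sum≡𝟎) (⊕-Properties.⁻¹-anti-homo‿- w w′)
    where
    open ≡-Reasoning
    sum≡𝟎 : (w ⊖ w′) ⊕ (x ⊖ x′) ≡ 𝟎
    sum≡𝟎 = begin
      (w ⊖ w′) ⊕ (x ⊖ x′)       ≡⟨ ⊕-Commutative.interchange w x (⊝ w′) (⊝ x′) ⟨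
      (w ⊕ x) ⊕ (⊝ w′ ⊕ ⊝ x′)   ≡⟨ cong₂ _⊕_ e (⊕-Properties.⁻¹-∙-comm w′ x′) ⟩
      (w′ ⊕ x′) ⊖ (w′ ⊕ x′)     ≡⟨ ⊕.inverseʳ (w′ ⊕ x′) ⟩
      𝟎                         ∎

  linComb : Vec Carrier d → Vec (Vec Carrier m) d → Vec Carrier m
  linComb []      []      = 𝟎
  linComb (a ∷ c) (v ∷ b) = a ⊙ v ⊕ linComb c b

  linComb-⊕ : ∀ (c c′ : Vec Carrier d) (b : Vec (Vec Carrier m) d) →
              linComb (c ⊕ c′) b ≡ linComb c b ⊕ linComb c′ b
  linComb-⊕ []      []        []      = sym (⊕.identityˡ 𝟎)
  linComb-⊕ (a ∷ c) (a′ ∷ c′) (v ∷ b) = trans (cong₂ _⊕_ (⊙-distribʳ a a′ v) (linComb-⊕ c c′ b))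
    (⊕-Commutative.interchange (a ⊙ v) (a′ ⊙ v) (linComb c b) (linComb c′ b))

  linComb-⊙ : ∀ a (c : Vec Carrier d) (b : Vec (Vec Carrier m) d) → linComb (a ⊙ c) b ≡ a ⊙ linComb c b
  linComb-⊙ a []      []      = sym (⊙-zeroʳ a)
  linComb-⊙ a (x ∷ c) (v ∷ b) =
    trans (cong₂ _⊕_ (⊙-assoc a x v) (linComb-⊙ a c b)) (sym (⊙-distribˡ a (x ⊙ v) (linComb c b)))

  linComb-𝟎 : ∀ (b : Vec (Vec Carrier m) d) → linComb 𝟎 b ≡ 𝟎
  linComb-𝟎 []      = refl
  linComb-𝟎 (v ∷ b) = trans (cong₂ _⊕_ (⊙-zeroˡ v) (linComb-𝟎 b)) (⊕.identityˡ 𝟎)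

  linComb-⊝ : ∀ (c : Vec Carrier d) (b : Vec (Vec Carrier m) d) → linComb (⊝ c) b ≡ ⊝ linComb c b
  linComb-⊝ c b = trans (cong (λ c → linComb c b) (⊝-as-⊙ c))
    (trans (linComb-⊙ (F.- F.1#) c b) (sym (⊝-as-⊙ (linComb c b))))

  linComb-⊖ : ∀ (c c′ : Vec Carrier d) (b : Vec (Vec Carrier m) d) →
              linComb (c ⊖ c′) b ≡ linComb c b ⊖ linComb c′ b
  linComb-⊖ c c′ b = trans (linComb-⊕ c (⊝ c′) b) (cong (linComb c b ⊕_) (linComb-⊝ c′ b))

-- Subspaces of F_q^n

module Subspaces (𝔽 : FiniteField) (n : ℕ) where
  open FiniteField 𝔽 using (Carrier; 0≢1; inverse; size; isCommutativeRing)
    renaming (_≟_ to _≟F_; _*_ to _*F_; 0# to 0F; 1# to 1F)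
  open IsCommutativeRing isCommutativeRing using () renaming (*-comm to *F-comm)
  open Space 𝔽 n
  open Vectors 𝔽

  private variable
    d i j k m : ℕ
    B D E U W : Subspace

  q : ℕ
  q = size

  F-enumeration : Enumeration Carrier
  F-enumeration = enumeration (FiniteField.elements 𝔽) (FiniteField.distinct 𝔽) (FiniteField.complete 𝔽)

  coefficients : ∀ d → Enumeration (Vec Carrier d)
  coefficients = vecEnumeration F-enumeration

  V-enumeration : Enumeration V
  V-enumeration = coefficients n

  tuples : ∀ m → Enumeration (Vec V m)
  tuples = vecEnumeration V-enumeration

  1<q : 1 < q
  1<q = injection⇒length≤ id ((0≢1 All.∷ All.[]) AllPairs.∷ (All.[] AllPairs.∷ AllPairs.[]))
          (λ _ _ e → e) (λ _ → FiniteField.complete 𝔽 _)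

  open QArithmetic q 1<q

  #_ : ∀ {ℓ} {P : Pred V ℓ} → Decidable P → ℕ
  # P? = count P? (list V-enumeration)

  ∣_∣ : Subspace → ℕ
  ∣ W ∣ = # dec W

  _≟V_ : ∀ (u v : V) → Dec (u ≡ v)
  _≟V_ = Vecₚ.≡-dec _≟F_

  _≈?_ : ∀ W U → Dec (W ≈ U)
  W ≈? U = ∀? V-enumeration (λ v → (dec W v →-dec dec U v) ×-dec (dec U v →-dec dec W v))

  Trivial? : ∀ W → Dec (Trivial W)
  Trivial? W = ∀? V-enumeration (λ v → dec W v →-dec v ≟V 0v)

  ≈-refl : W ≈ W
  ≈-refl v = id , id

  ≈-sym : W ≈ U → U ≈ W
  ≈-sym W≈U v = proj₂ (W≈U v) , proj₁ (W≈U v)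

  ≈-trans : W ≈ U → U ≈ E → W ≈ E
  ≈-trans W≈U U≈E v = proj₁ (U≈E v) ∘ proj₁ (W≈U v) , proj₂ (W≈U v) ∘ proj₂ (U≈E v)

  ≈-decSetoid : DecSetoid (lsuc 0ℓ) 0ℓ
  ≈-decSetoid = record
    { Carrier          = Subspace
    ; _≈_              = _≈_
    ; isDecEquivalence = record
      { isEquivalence = record
        { refl  = λ {W} → ≈-refl {W}
        ; sym   = λ {W} {U} → ≈-sym {W} {U}
        ; trans = λ {W} {U} {E} → ≈-trans {W} {U} {E}
        }
      ; _≟_ = _≈?_
      }
    }

  module ≈-Reasoning = SetoidReasoning (DecSetoid.setoid ≈-decSetoid)

  ∩-comm : ∀ W U → (W ∩ U) ≈ (U ∩ W)
  ∩-comm W U v = (λ { (w , u) → u , w }) , (λ { (u , w) → w , u })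

  ∩-congˡ : U ≈ E → (W ∩ U) ≈ (W ∩ E)
  ∩-congˡ U≈E v = (λ { (w , u) → w , proj₁ (U≈E v) u }) , (λ { (w , e) → w , proj₂ (U≈E v) e })

  ∋-⊝ : ∀ W {v} → W ∋ v → W ∋ (⊝ v)
  ∋-⊝ W {v} w = subst (W ∋_) (sym (⊝-as-⊙ v)) (·-closed W _ v w)

  ∋-⊖ : ∀ W {u v} → W ∋ u → W ∋ v → W ∋ (u ⊖ v)
  ∋-⊖ W {u} {v} wu wv = +-closed W u (⊝ v) wu (∋-⊝ W wv)

  _∋*_ : Subspace → Vec V d → Set
  W ∋* b = VecAll.All (W ∋_) b

  ∋-linComb : ∀ W {b : Vec V d} → W ∋* b → ∀ c → W ∋ linComb c b
  ∋-linComb W VecAll.[]         []      = 0∈ W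
  ∋-linComb W (wv VecAll.∷ wb) (a ∷ c) = +-closed W _ _ (·-closed W a _ wv) (∋-linComb W wb c)

  0ˢ : Subspace
  0ˢ = record
    { _∋_ = _≡ 0v
    ; dec = _≟V 0v
    ; 0∈ = refl
    ; +-closed = λ { _ _ refl refl → ⊕.identityˡ 0v }
    ; ·-closed = λ { a _ refl → ⊙-zeroʳ a }
    }

  0ˢ-⊆ : ∀ W → 0ˢ ⊆ W
  0ˢ-⊆ W _ refl = 0∈ W

  span : Vec V d → Subspace
  span {d} b = record
    { _∋_ = λ v → ∃[ c ] linComb c b ≡ v
    ; dec = λ v → ∃? (coefficients d) (λ c → linComb c b ≟V v)
    ; 0∈ = 𝟎 , linComb-𝟎 b
    ; +-closed = λ { _ _ (c , refl) (c′ , refl) → c ⊕ c′ , linComb-⊕ c c′ b }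
    ; ·-closed = λ { a _ (c , refl) → a ⊙ c , linComb-⊙ a c b }
    }

  span-least : ∀ {W d} {b : Vec V d} → W ∋* b → span b ⊆ W
  span-least {W = W} wb _ (c , refl) = ∋-linComb W wb c

  span-∷ : ∀ v (b : Vec V d) → span b ⊆ span (v ∷ b)
  span-∷ v b _ (c , refl) = 0F ∷ c , trans (cong (_⊕ linComb c b) (⊙-zeroˡ v)) (⊕.identityˡ _)

  span-∋* : ∀ (b : Vec V d) → span b ∋* b
  span-∋* []      = VecAll.[]
  span-∋* (v ∷ b) = (1F ∷ 𝟎 , trans (cong₂ _⊕_ (⊙-identityˡ v) (linComb-𝟎 b)) (⊕.identityʳ v))
                    VecAll.∷ VecAll.map (span-∷ v b _) (span-∋* b)

  _+⟨_⟩ : Subspace → Vec V d → Pred V 0ℓ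
  (W +⟨ b ⟩) v = ∃[ c ] W ∋ (v ⊖ linComb c b)

  _+⟨_⟩? : ∀ W (b : Vec V d) → Decidable (W +⟨ b ⟩)
  W +⟨ b ⟩? = λ v → ∃? (coefficients _) (λ c → dec W (v ⊖ linComb c b))

  IndependentOver : Subspace → Vec V d → Set
  IndependentOver W b = ∀ c → W ∋ linComb c b → c ≡ 𝟎

  IndependentOver? : ∀ W (b : Vec V d) → Dec (IndependentOver W b)
  IndependentOver? W b = ∀? (coefficients _) (λ c → dec W (linComb c b) →-dec Vecₚ.≡-dec _≟F_ c 𝟎)

  Independent : Vec V d → Set
  Independent = IndependentOver 0ˢ

  IndependentOver⇒Independent : ∀ {W d} {b : Vec V d} → IndependentOver W b → Independent b
  IndependentOver⇒Independent {W} indep c c≡0 = indep c (0ˢ-⊆ W _ c≡0)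

  -- (c, w) ↦ w + Σ c b is a bijection from F^d × W onto W + ⟨b⟩.
  ∣+⟨⟩∣ : ∀ {W d} {b : Vec V d} → IndependentOver W b → # (W +⟨ b ⟩?) ≡ ∣ W ∣ * q ^ d
  ∣+⟨⟩∣ {W} {d} {b} indep = begin
      # (W +⟨ b ⟩?)
    ≡⟨ count-bijection InW? (W +⟨ b ⟩?) (unique pairs) (unique V-enumeration) (complete pairs) (complete V-enumeration)
         translate injective (λ {x} → translate∈ x) (λ {v} → translate-onto v) ⟨
      count InW? (list pairs)
    ≡⟨ count-cartesianProductWith _,_ InW? {P = λ _ → ⊤} (λ _ → yes tt) ∣ W ∣ (list V-enumeration)
         (λ _ → refl) (λ _ → tt) (list (coefficients d)) ⟩
      count {P = λ _ → ⊤} (λ _ → yes tt) (list (coefficients d)) * ∣ W ∣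
    ≡⟨ cong (_* ∣ W ∣) (trans (count-all (λ _ → yes tt) {xs = list (coefficients d)} (All.tabulate (λ _ → tt)))
                             (length-vecEnumeration F-enumeration d)) ⟩
      q ^ d * ∣ W ∣
    ≡⟨ *-comm (q ^ d) ∣ W ∣ ⟩
      ∣ W ∣ * q ^ d ∎
    where
    open ≡-Reasoning
    pairs : Enumeration (Vec Carrier d × V)
    pairs = ×-enumeration (coefficients d) V-enumeration
    InW : Vec Carrier d × V → Set
    InW (_ , w) = W ∋ w
    InW? : Decidable InW
    InW? (_ , w) = dec W w
    translate : Vec Carrier d × V → V
    translate (c , w) = w ⊕ linComb c b
    translate∈ : ∀ x → InW x → (W +⟨ b ⟩) (translate x)
    translate∈ (c , w) w∈W = c , subst (W ∋_) (sym (⊕-Properties.//-rightDividesʳ (linComb c b) w)) w∈W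
    translate-onto : ∀ v → (W +⟨ b ⟩) v → ∃[ x ] InW x × translate x ≡ v
    translate-onto v (c , w) = (c , v ⊖ linComb c b) , w , ⊕-Properties.//-rightDividesˡ (linComb c b) v
    injective : ∀ {x x′} → InW x → InW x′ → translate x ≡ translate x′ → x ≡ x′
    injective {c , w} {c′ , w′} w∈W w′∈W e = cong₂ _,_ c≡c′
      (⊕-Properties.∙-cancelʳ (linComb c b) w w′ (subst (λ t → w ⊕ linComb c b ≡ w′ ⊕ linComb t b) (sym c≡c′) e))
      where
      c≡c′ : c ≡ c′
      c≡c′ = ⊕-Properties.x∙y⁻¹≈ε⇒x≈y c c′ (indep (c ⊖ c′)
        (subst (W ∋_) (sym (trans (linComb-⊖ c c′ b) (⊕-⊖-swap e))) (∋-⊖ W w′∈W w∈W)))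

  ∣0ˢ∣ : ∣ 0ˢ ∣ ≡ 1
  ∣0ˢ∣ = sym (count-bijection {P = λ _ → ⊤} (λ _ → yes tt) (dec 0ˢ) {xs = tt ∷ []}
    (All.[] AllPairs.∷ AllPairs.[]) (unique V-enumeration) (λ _ → here refl) (complete V-enumeration)
    (λ _ → 0v) (λ _ _ _ → refl) (λ _ → refl) (λ { refl → tt , tt , refl }))

  #-cong : ∀ {ℓ} {P Q : Pred V ℓ} (P? : Decidable P) (Q? : Decidable Q) →
           (∀ v → (P v → Q v) × (Q v → P v)) → # P? ≡ # Q?
  #-cong P? Q? P⇔Q = count-≐ P? Q? ((λ {v} → proj₁ (P⇔Q v)) , (λ {v} → proj₂ (P⇔Q v))) (list V-enumeration)

  #-mono : ∀ {ℓ} {P Q : Pred V ℓ} (P? : Decidable P) (Q? : Decidable Q) → (∀ {v} → P v → Q v) → # P? ≤ # Q?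
  #-mono P? Q? P⇒Q = count-mono P? Q? {xs = list V-enumeration} (All.tabulate (λ _ → P⇒Q))

  ∣∣-resp-≈ : W ≈ U → ∣ W ∣ ≡ ∣ U ∣
  ∣∣-resp-≈ {W} {U} = #-cong (dec W) (dec U)

  span⇔0ˢ+⟨⟩ : ∀ (b : Vec V d) v → (span b ∋ v → (0ˢ +⟨ b ⟩) v) × ((0ˢ +⟨ b ⟩) v → span b ∋ v)
  span⇔0ˢ+⟨⟩ b v = (λ { (c , refl) → c , ⊕.inverseʳ (linComb c b) })
                 , (λ { (c , e) → c , sym (⊕-Properties.x∙y⁻¹≈ε⇒x≈y v (linComb c b) e) })

  ∣span∣ : ∀ {d} {b : Vec V d} → Independent b → ∣ span b ∣ ≡ q ^ d
  ∣span∣ {d} {b} indep = begin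
    ∣ span b ∣        ≡⟨ #-cong (dec (span b)) (0ˢ +⟨ b ⟩?) (span⇔0ˢ+⟨⟩ b) ⟩
    # (0ˢ +⟨ b ⟩?)   ≡⟨ ∣+⟨⟩∣ {W = 0ˢ} indep ⟩
    ∣ 0ˢ ∣ * q ^ d    ≡⟨ cong (_* q ^ d) ∣0ˢ∣ ⟩
    1 * q ^ d         ≡⟨ *-identityˡ (q ^ d) ⟩
    q ^ d             ∎
    where open ≡-Reasoning

  IsBasis : Subspace → Vec V d → Set
  IsBasis W b = W ∋* b × Independent b × W ⊆ span b

  private
    lincomb≡linComb : ∀ (c : Fin d → Carrier) (b : Fin d → V) → lincomb c b ≡ linComb (tabulate c) (tabulate b)
    lincomb≡linComb {zero}  c b = refl
    lincomb≡linComb {suc d} c b = cong (c Fin.zero · b Fin.zero ⊕_) (lincomb≡linComb (c ∘ Fin.suc) (b ∘ Fin.suc))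

    lincomb-lookup : ∀ (c : Fin d → Carrier) (b : Vec V d) → lincomb c (lookup b) ≡ linComb (tabulate c) b
    lincomb-lookup c b = trans (lincomb≡linComb c (lookup b)) (cong (linComb (tabulate c)) (Vecₚ.tabulate∘lookup b))

    lookups-zero : ∀ (c : Vec Carrier d) → (∀ j → lookup c j ≡ 0F) → c ≡ 𝟎
    lookups-zero []      _    = refl
    lookups-zero (a ∷ c) all-zero = cong₂ _∷_ (all-zero Fin.zero) (lookups-zero c (all-zero ∘ Fin.suc))

  Dim⇒IsBasis : ∀ {W d} → Dim W d → Σ (Vec V d) (IsBasis W)
  Dim⇒IsBasis {W} (b , b∈W , independent , spanning) = tabulate b , VecAllₚ.tabulate⁺ b∈W , indep , spans
    where
    indep : Independent (tabulate b)
    indep c e = lookups-zero c (independent (lookup c)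
      (trans (lincomb≡linComb (lookup c) b) (trans (cong (λ t → linComb t (tabulate b)) (Vecₚ.tabulate∘lookup c)) e)))
    spans : W ⊆ span (tabulate b)
    spans v w with spanning v w
    ... | c , refl = tabulate c , sym (lincomb≡linComb c b)

  IsBasis⇒Dim : ∀ {W d} {b : Vec V d} → IsBasis W b → Dim W d
  IsBasis⇒Dim {W} {b = b} (b∈W , indep , spans) = lookup b , VecAllₚ.lookup⁺ b∈W , independent , spanning
    where
    independent : ∀ c → lincomb c (lookup b) ≡ 0v → ∀ j → c j ≡ 0F
    independent c e j = begin
      c j                   ≡⟨ Vecₚ.lookup∘tabulate c j ⟨
      lookup (tabulate c) j ≡⟨ cong (λ t → lookup t j) (indep (tabulate c) (trans (sym (lincomb-lookup c b)) e)) ⟩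
      lookup 𝟎 j            ≡⟨ Vecₚ.lookup-replicate j 0F ⟩
      0F                    ∎
      where open ≡-Reasoning
    spanning : ∀ v → W ∋ v → ∃[ c ] v ≡ lincomb c (lookup b)
    spanning v w with spans v w
    ... | c , refl = lookup c , sym (trans (lincomb-lookup (lookup c) b) (cong (λ t → linComb t b) (Vecₚ.tabulate∘lookup c)))

  ∣Dim∣ : ∀ W → Dim W d → ∣ W ∣ ≡ q ^ d
  ∣Dim∣ W D with Dim⇒IsBasis {W} D
  ... | b , b∈W , indep , spans = trans (∣∣-resp-≈ {W} {span b} (λ v → spans v , span-least {W} b∈W v)) (∣span∣ indep)

  Dim-unique : ∀ W → Dim W i → Dim W j → i ≡ j
  Dim-unique W Di Dj = ^-injective (trans (sym (∣Dim∣ W Di)) (∣Dim∣ W Dj))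

  ∣∣-mono : W ⊆ U → ∣ W ∣ ≤ ∣ U ∣
  ∣∣-mono {W} {U} W⊆U = #-mono (dec W) (dec U) (W⊆U _)

  Dim-mono : ∀ W U → W ⊆ U → Dim W i → Dim U j → i ≤ j
  Dim-mono W U W⊆U Di Dj = ^-reflects-≤ (subst₂ _≤_ (∣Dim∣ W Di) (∣Dim∣ U Dj) (∣∣-mono {W} {U} W⊆U))

  Dim-resp-≈ : ∀ W U → W ≈ U → Dim W d → Dim U d
  Dim-resp-≈ W U W≈U (b , b∈W , independent , spanning) =
    b , (λ j → proj₁ (W≈U (b j)) (b∈W j)) , independent , (λ v → spanning v ∘ proj₂ (W≈U v))

  Dim-span : ∀ {d} {b : Vec V d} → Independent b → Dim (span b) d
  Dim-span {b = b} indep = IsBasis⇒Dim {span b} (span-∋* b , indep , λ _ → id)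

  ⊆-size⇒⊇ : ∀ {ℓ} {P Q : Pred V ℓ} (P? : Decidable P) (Q? : Decidable Q) →
             (∀ {v} → P v → Q v) → # Q? ≤ # P? → ∀ v → Q v → P v
  ⊆-size⇒⊇ P? Q? P⊆Q #Q≤#P v qv with P? v
  ... | yes pv = pv
  ... | no ¬pv = contradiction #Q≤#P (<⇒≱ (count-strict P? Q? (All.tabulate (λ _ → P⊆Q)) (complete V-enumeration v) qv ¬pv))

  ⊆-Dim⇒≈ : ∀ W U → W ⊆ U → Dim W d → Dim U d → W ≈ U
  ⊆-Dim⇒≈ W U W⊆U DW DU v =
    W⊆U v , ⊆-size⇒⊇ (dec W) (dec U) (W⊆U _) (≤-reflexive (trans (∣Dim∣ U DU) (sym (∣Dim∣ W DW)))) v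

  #+⟨⟩ : ∀ W {i d} {b : Vec V d} → IndependentOver W b → Dim W i → # (W +⟨ b ⟩?) ≡ q ^ (i + d)
  #+⟨⟩ W {i} {d} indep DW = trans (∣+⟨⟩∣ {W} indep) (trans (cong (_* q ^ d) (∣Dim∣ W DW)) (sym (^-distribˡ-+-* q i d)))

  #≤q^n : ∀ {ℓ} {P : Pred V ℓ} (P? : Decidable P) → # P? ≤ q ^ n
  #≤q^n P? = subst (# P? ≤_) (length-vecEnumeration F-enumeration n) (length-filter P? (list V-enumeration))

  Independent-length : ∀ {d} {b : Vec V d} → Independent b → d ≤ n
  Independent-length indep = ^-reflects-≤ (subst (_≤ q ^ n) (∣span∣ indep) (#≤q^n (dec (span _))))

  +⟨⟩⊆⇒≤ : ∀ W B {i k d} {b : Vec V d} → IndependentOver W b → Dim W i → Dim B k →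
           (∀ v → (W +⟨ b ⟩) v → B ∋ v) → i + d ≤ k
  +⟨⟩⊆⇒≤ W B indep DW DB ⊆B = ^-reflects-≤ (subst₂ _≤_ (#+⟨⟩ W indep DW) (∣Dim∣ B DB)
    (#-mono (W +⟨ _ ⟩?) (dec B) (⊆B _)))

  ⊆+⟨⟩⇒≤ : ∀ W B {i k d} {b : Vec V d} → IndependentOver W b → Dim W i → Dim B k →
           (∀ v → B ∋ v → (W +⟨ b ⟩) v) → k ≤ i + d
  ⊆+⟨⟩⇒≤ W B indep DW DB B⊆ = ^-reflects-≤ (subst₂ _≤_ (∣Dim∣ B DB) (#+⟨⟩ W indep DW)
    (#-mono (dec B) (W +⟨ _ ⟩?) (B⊆ _)))

  IndependentIn : Subspace → Subspace → Vec V d → Set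
  IndependentIn W B b = IndependentOver W b × B ∋* b

  IndependentIn? : ∀ W B (b : Vec V d) → Dec (IndependentIn W B b)
  IndependentIn? W B b = IndependentOver? W b ×-dec VecAll.all? (dec B) b

  IndependentOver-[] : ∀ W → IndependentOver W []
  IndependentOver-[] W [] _ = refl

  IndependentOver-∷ : ∀ W {d} {b : Vec V d} {v} → IndependentOver W b → ¬ (W +⟨ b ⟩) v → IndependentOver W (v ∷ b)
  IndependentOver-∷ W {b = b} {v} indep v∉ (a ∷ c) w with a ≟F 0F
  ... | yes refl = cong (0F ∷_) (indep c (subst (W ∋_) (trans (cong (_⊕ linComb c b) (⊙-zeroˡ v)) (⊕.identityˡ _)) w))
  ... | no a≢0 with inverse a a≢0
  ...   | a⁻¹ , aa⁻¹≡1 = contradiction (⊝ (a⁻¹ ⊙ c) , subst (W ∋_) scaled (·-closed W a⁻¹ _ w)) v∉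
    where
    open ≡-Reasoning
    scaled : a⁻¹ ⊙ (a ⊙ v ⊕ linComb c b) ≡ v ⊖ linComb (⊝ (a⁻¹ ⊙ c)) b
    scaled = begin
      a⁻¹ ⊙ (a ⊙ v ⊕ linComb c b)
        ≡⟨ ⊙-distribˡ a⁻¹ (a ⊙ v) (linComb c b) ⟩
      a⁻¹ ⊙ a ⊙ v ⊕ a⁻¹ ⊙ linComb c b
        ≡⟨ cong (_⊕ a⁻¹ ⊙ linComb c b) (⊙-assoc a⁻¹ a v) ⟨
      (a⁻¹ *F a) ⊙ v ⊕ a⁻¹ ⊙ linComb c b
        ≡⟨ cong (λ x → x ⊙ v ⊕ a⁻¹ ⊙ linComb c b) (trans (*F-comm a⁻¹ a) aa⁻¹≡1) ⟩
      1F ⊙ v ⊕ a⁻¹ ⊙ linComb c b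
        ≡⟨ cong₂ _⊕_ (⊙-identityˡ v) (sym (linComb-⊙ a⁻¹ c b)) ⟩
      v ⊕ linComb (a⁻¹ ⊙ c) b
        ≡⟨ cong (v ⊕_) (⊕-Properties.⁻¹-involutive (linComb (a⁻¹ ⊙ c) b)) ⟨
      v ⊖ ⊝ linComb (a⁻¹ ⊙ c) b
        ≡⟨ cong (v ⊖_) (linComb-⊝ (a⁻¹ ⊙ c) b) ⟨
      v ⊖ linComb (⊝ (a⁻¹ ⊙ c)) b ∎

  IndependentOver-tail : ∀ W {d} {b : Vec V d} {v} → IndependentOver W (v ∷ b) → IndependentOver W b
  IndependentOver-tail W {b = b} {v} indep c w = Vecₚ.∷-injectiveʳ (indep (0F ∷ c)
    (subst (W ∋_) (sym (trans (cong (_⊕ linComb c b) (⊙-zeroˡ v)) (⊕.identityˡ _))) w))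

  IndependentOver-head : ∀ W {d} {b : Vec V d} {v} → IndependentOver W (v ∷ b) → ¬ (W +⟨ b ⟩) v
  IndependentOver-head W {b = b} {v} indep (c , w) = 0≢1 (sym (Vecₚ.∷-injectiveˡ (indep (1F ∷ ⊝ c)
    (subst (W ∋_) (sym (cong₂ _⊕_ (⊙-identityˡ v) (linComb-⊝ c b))) w))))

  +⟨⟩-⊆ : ∀ W B {d} {b : Vec V d} → W ⊆ B → B ∋* b → ∀ v → (W +⟨ b ⟩) v → B ∋ v
  +⟨⟩-⊆ W B {b = b} W⊆B b∈B v (c , w) =
    subst (B ∋_) (⊕-Properties.//-rightDividesˡ (linComb c b) v) (+-closed B _ _ (W⊆B _ w) (∋-linComb B b∈B c))

  extend-or-⊆ : ∀ W B {d} {b : Vec V d} → IndependentOver W b →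
                (∀ v → B ∋ v → (W +⟨ b ⟩) v) ⊎ ∃[ v ] (B ∋ v × IndependentOver W (v ∷ b))
  extend-or-⊆ W B {b = b} indep with ⊆-or-counterexample V-enumeration (dec B) (W +⟨ b ⟩?)
  ... | inj₁ B⊆                 = inj₁ B⊆
  ... | inj₂ (v , v∈B , v∉)     = inj₂ (v , v∈B , IndependentOver-∷ W indep v∉)

  Dim-exists : ∀ W → ∃[ d ] Dim W d
  Dim-exists W = grow (suc n) [] VecAll.[] (IndependentOver-[] 0ˢ) (n<1+n n)
    where
    grow : ∀ fuel {j} (b : Vec V j) → W ∋* b → Independent b → n < j + fuel → ∃[ d ] Dim W d
    grow zero {j} b _ indep n<j = contradiction (Independent-length indep) (<⇒≱ (subst (n <_) (+-identityʳ j) n<j))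
    grow (suc fuel) {j} b b∈W indep bound with extend-or-⊆ 0ˢ W indep
    ... | inj₁ W⊆ = j , IsBasis⇒Dim {W} (b∈W , indep , λ v w → proj₂ (span⇔0ˢ+⟨⟩ b v) (W⊆ v w))
    ... | inj₂ (v , v∈W , indep′) = grow fuel (v ∷ b) (v∈W VecAll.∷ b∈W) indep′ (subst (n <_) (+-suc j fuel) bound)

  extend : ∀ W B {i k} → Dim W i → Dim B k → ∀ t {j} {b : Vec V j} →
           IndependentIn W B b → i + (t + j) ≤ k → ∃[ xs ] IndependentIn W B (xs ++ b)
  extend W B DW DB zero indep _ = [] , indep
  extend W B {i} {k} DW DB (suc t) {j} indep bound
    with extend W B DW DB t indep (≤-trans (+-monoʳ-≤ i (n≤1+n (t + j))) bound)
  ... | xs , indep′ , xs++b∈B with extend-or-⊆ W B indep′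
  ...   | inj₂ (v , v∈B , indep″) = v ∷ xs , indep″ , v∈B VecAll.∷ xs++b∈B
  ...   | inj₁ B⊆ =
    contradiction (≤-trans (subst (_≤ k) (+-suc i (t + j)) bound) (⊆+⟨⟩⇒≤ W B indep′ DW DB B⊆)) (n≮n _)

  #IndependentIn : ∀ W B → W ⊆ B → ∀ j → count (IndependentIn? W B) (list (tuples j)) ≡ qFalling ∣ B ∣ ∣ W ∣ j
  #IndependentIn W B W⊆B zero = count-all (IndependentIn? W B) {xs = [] ∷ []} ((IndependentOver-[] W , VecAll.[]) All.∷ All.[])
  #IndependentIn W B W⊆B (suc j) =
    trans (count-cartesianProductWith (λ b v → v ∷ b) (IndependentIn? W B) (IndependentIn? W B) K (list V-enumeration)
             extensions shorten (list (tuples j)))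
          (cong (_* K) (#IndependentIn W B W⊆B j))
    where
    K = ∣ B ∣ ∸ ∣ W ∣ * q ^ j
    shorten : ∀ {b : Vec V j} {v} → IndependentIn W B (v ∷ b) → IndependentIn W B b
    shorten (indep , _ VecAll.∷ b∈B) = IndependentOver-tail W indep , b∈B
    -- Each vector of B either lies in W + ⟨b⟩ (∣ W ∣ q^j of them) or extends b.
    extensions : ∀ {b : Vec V j} → IndependentIn W B b → count (λ v → IndependentIn? W B (v ∷ b)) (list V-enumeration) ≡ K
    extensions {b} (indep , b∈B) = begin
        count (λ v → IndependentIn? W B (v ∷ b)) LV
      ≡⟨ m+n∸m≡n (# (W +⟨ b ⟩?)) _ ⟨
        (# (W +⟨ b ⟩?) + count (λ v → IndependentIn? W B (v ∷ b)) LV) ∸ # (W +⟨ b ⟩?)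
      ≡⟨ cong₂ _∸_ (sym split) (∣+⟨⟩∣ {W} indep) ⟩
        K ∎
      where
      open ≡-Reasoning
      LV = list V-enumeration
      split : ∣ B ∣ ≡ # (W +⟨ b ⟩?) + count (λ v → IndependentIn? W B (v ∷ b)) LV
      split = trans (count-split (dec B) (W +⟨ b ⟩?) LV) (cong₂ _+_
        (count-≐ (dec B ∩? W +⟨ b ⟩?) (W +⟨ b ⟩?) (proj₂ , λ {v} w → +⟨⟩-⊆ W B W⊆B b∈B v w , w) LV)
        (count-≐ (dec B ∩? ∁? (W +⟨ b ⟩?)) (λ v → IndependentIn? W B (v ∷ b))
          ((λ { (v∈B , v∉) → IndependentOver-∷ W indep v∉ , v∈B VecAll.∷ b∈B })
          , λ { (indep′ , v∈B VecAll.∷ _) → v∈B , IndependentOver-head W indep′ }) LV))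

  spans-of-dimension : ∀ D {m} {b : Vec V m} → Independent b → D ∋* b → Dim D m → span b ≈ D
  spans-of-dimension D indep b∈D DD = ⊆-Dim⇒≈ (span _) D (span-least {D} b∈D) (Dim-span indep) DD

  -- Each m-dimensional member of L contains qFalling (q^m) 1 m independent m-tuples, and every tuple satisfying G
  -- is an independent tuple of exactly one member of L.
  count-by-spans : ∀ {m} (L : List Subspace) → AllPairs (λ S T → ¬ S ≈ T) L → All (λ D → Dim D m) L →
                   {G : Pred (Vec V m) 0ℓ} (G? : Decidable G) → (∀ {b} → G b → Independent b) →
                   (∀ {b} → G b → Any (_∋* b) L) → All (λ D → ∀ {b} → Independent b → D ∋* b → G b) L →
                   count G? (list (tuples m)) ≡ length L * qFalling (q ^ m) 1 m
  count-by-spans {m} [] _ _ G? _ covered _ =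
    count-none G? {xs = list (tuples m)} (All.tabulate (λ _ g → case covered g of λ ()))
  count-by-spans {m} (D ∷ L) (D∉L AllPairs.∷ L!) (DD All.∷ dims) {G} G? independent covered (inD⇒G All.∷ inL⇒G) = begin
      count G? tuplesₘ
    ≡⟨ count-split G? (IndependentIn? 0ˢ D) tuplesₘ ⟩
      count (G? ∩? IndependentIn? 0ˢ D) tuplesₘ + count G′? tuplesₘ
    ≡⟨ cong₂ _+_
         (count-≐ (G? ∩? IndependentIn? 0ˢ D) (IndependentIn? 0ˢ D)
                  (proj₂ , λ x → inD⇒G (proj₁ x) (proj₂ x) , x) tuplesₘ)
         (count-by-spans L L! dims G′? (independent ∘ proj₁) covered′
           (All.zipWith (λ {D′} → inL⇒G′ {D′}) (D∉L , All.zipWith id (dims , inL⇒G)))) ⟩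
      count (IndependentIn? 0ˢ D) tuplesₘ + length L * qFalling (q ^ m) 1 m
    ≡⟨ cong (_+ _) (trans (#IndependentIn 0ˢ D (0ˢ-⊆ D) m) (cong₂ (λ x y → qFalling x y m) (∣Dim∣ D DD) ∣0ˢ∣)) ⟩
      qFalling (q ^ m) 1 m + length L * qFalling (q ^ m) 1 m ∎
    where
    open ≡-Reasoning
    tuplesₘ : List (Vec V m)
    tuplesₘ = list (tuples m)
    G′? : Decidable (λ b → G b × ¬ IndependentIn 0ˢ D b)
    G′? = G? ∩? ∁? (IndependentIn? 0ˢ D)
    covered′ : ∀ {b} → (G b × ¬ IndependentIn 0ˢ D b) → Any (_∋* b) L
    covered′ (g , ¬inD) with covered g
    ... | here b∈D = contradiction (independent g , b∈D) ¬inD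
    ... | there b∈L = b∈L
    inL⇒G′ : ∀ {D′} → ¬ D ≈ D′ × Dim D′ m × (∀ {b} → Independent b → D′ ∋* b → G b) →
             ∀ {b} → Independent b → D′ ∋* b → (G b × ¬ IndependentIn 0ˢ D b)
    inL⇒G′ {D′} (D≉D′ , DD′ , inD′⇒G) {b} indep b∈D′ = inD′⇒G indep b∈D′ , λ (_ , b∈D) →
      D≉D′ (≈-trans {D} {span b} {D′} (≈-sym {span b} {D} (spans-of-dimension D indep b∈D DD))
                                      (spans-of-dimension D′ indep b∈D′ DD′))

  subspaces : Subspace → ℕ → List Subspace
  subspaces B m = deduplicate _≈?_ (List.map span (filter (IndependentIn? 0ˢ B) (list (tuples m))))

  subspaces-sound : ∀ B m → All (λ D → D ⊆ B × Dim D m) (subspaces B m)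
  subspaces-sound B m = Allₚ.deduplicate⁺ _≈?_ (Allₚ.map⁺ (All.map
    (λ (indep , b∈B) → span-least {B} b∈B , Dim-span indep) (Allₚ.all-filter (IndependentIn? 0ˢ B) (list (tuples m)))))

  subspaces-complete : ∀ B m D → D ⊆ B → Dim D m → Any (D ≈_) (subspaces B m)
  subspaces-complete B m D D⊆B DD with Dim⇒IsBasis {D} DD
  ... | b , b∈D , indep , spans =
    Anyₚ.deduplicate⁺ _≈?_ (λ {X} {Y} Y≈X D≈X → ≈-trans {D} {X} {Y} D≈X (≈-sym {Y} {X} Y≈X))
    (Any.map (λ { refl → λ v → spans v , span-least {D} b∈D v })
      (∈-map⁺ span (∈-filter⁺ (IndependentIn? 0ˢ B) (complete (tuples m) b) (indep , VecAll.map (D⊆B _) b∈D))))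

  subspaces-distinct : ∀ B m → AllPairs (λ S T → ¬ S ≈ T) (subspaces B m)
  subspaces-distinct B m = deduplicate-! ≈-decSetoid _

  IndependentOver⇒span-∩-trivial : ∀ W {d} {b : Vec V d} → IndependentOver W b → Trivial (span b ∩ W)
  IndependentOver⇒span-∩-trivial W {b = b} indep _ ((c , refl) , w) =
    trans (cong (λ c → linComb c b) (indep c w)) (linComb-𝟎 b)

  ∩-trivial⇒IndependentOver : ∀ W D {d} {b : Vec V d} →
                              Trivial (D ∩ W) → D ∋* b → Independent b → IndependentOver W b
  ∩-trivial⇒IndependentOver W D D∩W-trivial b∈D indep c w = indep c (D∩W-trivial _ (∋-linComb D b∈D c , w))

  #complements : ∀ W B m → W ⊆ B →
                 count (λ D → Trivial? (D ∩ W)) (subspaces B m) * qFalling (q ^ m) 1 m ≡ qFalling ∣ B ∣ ∣ W ∣ m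
  #complements W B m W⊆B = sym (trans (sym (#IndependentIn W B W⊆B m))
    (count-by-spans L (AllPairsₚ.filter⁺ complementary? (subspaces-distinct B m))
      (Allₚ.filter⁺ complementary? (All.map proj₂ (subspaces-sound B m)))
      (IndependentIn? W B) (IndependentOver⇒Independent {W} ∘ proj₁) covered
      (All.zipWith (λ {D} → tuples-of-complement {D})
        (Allₚ.filter⁺ complementary? (subspaces-sound B m) , Allₚ.all-filter complementary? (subspaces B m)))))
    where
    complementary? : ∀ D → Dec (Trivial (D ∩ W))
    complementary? D = Trivial? (D ∩ W)
    L : List Subspace
    L = filter complementary? (subspaces B m)
    covered : ∀ {b : Vec V m} → IndependentIn W B b → Any (_∋* b) L
    covered {b} (indep , b∈B) = Any.map (λ {X} span≈X → VecAll.map (λ {v} → proj₁ (span≈X v)) (span-∋* b))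
      (Any-filter⁺ complementary?
        (λ {X} span≈X v (x , w) → IndependentOver⇒span-∩-trivial W indep v (proj₂ (span≈X v) x , w))
        (subspaces-complete B m (span b) (span-least {B} b∈B) (Dim-span (IndependentOver⇒Independent {W} indep))))
    tuples-of-complement : ∀ {D} → (D ⊆ B × Dim D m) × Trivial (D ∩ W) →
                           ∀ {b} → Independent b → D ∋* b → IndependentIn W B b
    tuples-of-complement {D} ((D⊆B , _) , D∩W≡0) indep b∈D =
      ∩-trivial⇒IndependentOver W D D∩W≡0 b∈D indep , VecAll.map (D⊆B _) b∈D

  module _ (B D E : Subspace) (D∩E≡0 : Trivial (D ∩ E)) {e} (DE : Dim E e) where
    private
      bE : Vec V e
      bE = proj₁ (Dim⇒IsBasis {E} DE)
      bE∈E : E ∋* bE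
      bE∈E = proj₁ (proj₂ (Dim⇒IsBasis {E} DE))
      E⊆span : E ⊆ span bE
      E⊆span = proj₂ (proj₂ (proj₂ (Dim⇒IsBasis {E} DE)))
      indep : IndependentOver D bE
      indep = ∩-trivial⇒IndependentOver D E (λ v (e , d) → D∩E≡0 v (d , e)) bE∈E
                (proj₁ (proj₂ (proj₂ (Dim⇒IsBasis {E} DE))))

    -- D + ⟨bE⟩ is D + E, and it has q^(a + e) elements.
    sum-Dim≤ : D ⊆ B → E ⊆ B → ∀ {a k} → Dim D a → Dim B k → a + e ≤ k
    sum-Dim≤ D⊆B E⊆B DD DB = +⟨⟩⊆⇒≤ D B indep DD DB (+⟨⟩-⊆ D B D⊆B (VecAll.map (E⊆B _) bE∈E))

    DirectSum-of-Dim : D ⊆ B → E ⊆ B → ∀ {a k} → Dim D a → Dim B k → a + e ≡ k → DirectSum B D E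
    DirectSum-of-Dim D⊆B E⊆B DD DB a+e≡k = (λ v → decompose v , recompose v) , D∩E≡0
      where
      B⊆D+E : ∀ v → B ∋ v → (D +⟨ bE ⟩) v
      B⊆D+E = ⊆-size⇒⊇ (D +⟨ bE ⟩?) (dec B) (+⟨⟩-⊆ D B D⊆B (VecAll.map (E⊆B _) bE∈E) _)
        (≤-reflexive (trans (∣Dim∣ B DB) (trans (cong (q ^_) (sym a+e≡k)) (sym (#+⟨⟩ D indep DD)))))
      decompose : ∀ v → B ∋ v → ∃[ d ] ∃[ e ] (D ∋ d × E ∋ e × v ≡ d +v e)
      decompose v v∈B with B⊆D+E v v∈B
      ... | c , d =
        v ⊖ linComb c bE , linComb c bE , d , ∋-linComb E bE∈E c , sym (⊕-Properties.//-rightDividesˡ (linComb c bE) v)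
      recompose : ∀ v → ∃[ d ] ∃[ e ] (D ∋ d × E ∋ e × v ≡ d +v e) → B ∋ v
      recompose v (d , e , d∈D , e∈E , refl) = +-closed B d e (D⊆B d d∈D) (E⊆B e e∈E)

    DirectSum⇒Dim : DirectSum B D E → ∀ {k} → Dim B k → Dim D (k ∸ e)
    DirectSum⇒Dim ((sum , _)) {k} DB with Dim-exists D
    ... | a , DD = subst (Dim D) (trans (sym (m+n∸n≡m a e)) (cong (_∸ e) a+e≡k)) DD
      where
      D⊆B : D ⊆ B
      D⊆B v d = proj₂ (sum v) (v , 0v , d , 0∈ E , sym (⊕.identityʳ v))
      E⊆B : E ⊆ B
      E⊆B v e = proj₂ (sum v) (0v , v , 0∈ D , e , sym (⊕.identityˡ v))
      B⊆D+E : ∀ v → B ∋ v → (D +⟨ bE ⟩) v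
      B⊆D+E v v∈B with proj₁ (sum v) v∈B
      ... | d , e , d∈D , e∈E , refl with E⊆span e e∈E
      ...   | c , refl = c , subst (D ∋_) (sym (⊕-Properties.//-rightDividesʳ (linComb c bE) d)) d∈D
      a+e≡k : a + e ≡ k
      a+e≡k = ≤-antisym (sum-Dim≤ D⊆B E⊆B DD DB) (⊆+⟨⟩⇒≤ D B indep DD DB B⊆D+E)

  DirectSum-resp-≈ : ∀ B D E E′ → E ≈ E′ → DirectSum B D E → DirectSum B D E′
  DirectSum-resp-≈ B D E E′ E≈E′ (sum , D∩E≡0) =
    (λ v → (λ v∈B → let (d , e , d∈D , e∈E , v≡) = proj₁ (sum v) v∈B
                     in d , e , d∈D , proj₁ (E≈E′ e) e∈E , v≡)
         , (λ (d , e , d∈D , e∈E′ , v≡) → proj₂ (sum v) (d , e , d∈D , proj₂ (E≈E′ e) e∈E′ , v≡)))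
    , λ v (d , e) → D∩E≡0 v (d , proj₂ (E≈E′ v) e)

  private
    qFalling-nonZero : ∀ m → NonZero (qFalling (q ^ m) 1 m)
    qFalling-nonZero m = >-nonZero (qFalling-positive m ≤-refl)

  length-subspaces : ∀ B {k} → Dim B k → ∀ i → length (subspaces B i) ≡ gauss q k i
  length-subspaces B {k} DB i = *-cancelʳ-≡ _ _ (qFalling (q ^ i) 1 i) {{qFalling-nonZero i}} (begin
      length (subspaces B i) * qFalling (q ^ i) 1 i
    ≡⟨ cong (_* qFalling (q ^ i) 1 i)
            (count-all (λ D → Trivial? (D ∩ 0ˢ)) {xs = subspaces B i} (All.tabulate (λ _ v (_ , v≡0) → v≡0))) ⟨
      count (λ D → Trivial? (D ∩ 0ˢ)) (subspaces B i) * qFalling (q ^ i) 1 i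
    ≡⟨ #complements 0ˢ B i (0ˢ-⊆ B) ⟩
      qFalling ∣ B ∣ ∣ 0ˢ ∣ i
    ≡⟨ cong₂ (λ x y → qFalling x y i) (∣Dim∣ B DB) ∣0ˢ∣ ⟩
      qFalling (q ^ k) 1 i
    ≡⟨ qFalling-gauss k i ⟩
      gauss q k i * qFalling (q ^ i) 1 i ∎)
    where open ≡-Reasoning

  #complements-Dim : ∀ W B {i m} → W ⊆ B → Dim W i → Dim B (i + m) →
                     count (λ D → Trivial? (D ∩ W)) (subspaces B m) ≡ q ^ (i * m)
  #complements-Dim W B {i} {m} W⊆B DW DB = *-cancelʳ-≡ _ _ (qFalling (q ^ m) 1 m) {{qFalling-nonZero m}} (begin
      count (λ D → Trivial? (D ∩ W)) (subspaces B m) * qFalling (q ^ m) 1 m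
    ≡⟨ #complements W B m W⊆B ⟩
      qFalling ∣ B ∣ ∣ W ∣ m
    ≡⟨ cong₂ (λ x y → qFalling x y m) (∣Dim∣ B DB) (∣Dim∣ W DW) ⟩
      qFalling (q ^ (i + m)) (q ^ i) m
    ≡⟨ qFalling-scale i m m ⟩
      q ^ (i * m) * qFalling (q ^ m) 1 m ∎)
    where open ≡-Reasoning

  Dim? : ∀ W d → Dec (Dim W d)
  Dim? W d with Dim-exists W
  ... | d′ , DW with d′ ≟ d
  ...   | yes refl = yes DW
  ...   | no d′≢d  = no (d′≢d ∘ Dim-unique W DW)

  -- The family 𝓕

  module WithFamily (k : ℕ) (𝓕 : Family) (dims : All (λ C → Dim C k) 𝓕) (A B : Subspace) (B∈𝓕 : B ∈F 𝓕) where

    Dim-∈F : ∀ C → C ∈F 𝓕 → Dim C k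
    Dim-∈F C = All.lookupWith {R = λ _ → Dim C k} (λ {X} DX C≈X → Dim-resp-≈ X C (≈-sym {C} {X} C≈X) DX) dims

    DB : Dim B k
    DB = Dim-∈F B B∈𝓕

    IsI-unique : IsI 𝓕 A B i → IsI 𝓕 A B j → i ≡ j
    IsI-unique (inj₁ (_ , lift Di)) (inj₁ (_ , lift Dj)) = Dim-unique (A ∩ B) Di Dj
    IsI-unique (inj₁ (A∩B≠0 , _)) (inj₂ (A∩B≡0 , _)) = contradiction A∩B≡0 A∩B≠0
    IsI-unique (inj₂ (A∩B≡0 , _)) (inj₁ (A∩B≠0 , _)) = contradiction A∩B≡0 A∩B≠0
    IsI-unique (inj₂ (_ , (C , C∈ , lift B∩C≠0 , lift Di) , i-least))
               (inj₂ (_ , (C′ , C′∈ , lift B∩C′≠0 , lift Dj) , j-least)) =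
      ≤-antisym (i-least C′ C′∈ B∩C′≠0 _ Dj) (j-least C C∈ B∩C≠0 _ Di)

    InI⇒Dim : ∀ C → InI 𝓕 A B C → IsI 𝓕 A B i → Dim (B ∩ C) i
    InI⇒Dim C (inj₁ (_ , lift C≈A)) (inj₁ (_ , lift Di)) = Dim-resp-≈ (A ∩ B) (B ∩ C) (begin
      A ∩ B ≈⟨ ∩-comm A B ⟩
      B ∩ A ≈⟨ ∩-congˡ {C} {A} {B} C≈A ⟨
      B ∩ C ∎) Di
      where open ≈-Reasoning
    InI⇒Dim C (inj₁ (A∩B≠0 , _)) (inj₂ (A∩B≡0 , _)) = contradiction A∩B≡0 A∩B≠0
    InI⇒Dim C (inj₂ (_ , _ , j , isJ , lift Dj)) isI = subst (Dim (B ∩ C)) (IsI-unique isJ isI) Dj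

    InI-witness : IsI 𝓕 A B i → ∃[ C ] InI 𝓕 A B C
    InI-witness (inj₁ (A∩B≠0 , _)) = A , inj₁ (A∩B≠0 , lift (≈-refl {A}))
    InI-witness isI@(inj₂ (A∩B≡0 , (C , C∈ , _ , lift Di) , _)) = C , inj₂ (A∩B≡0 , C∈ , _ , isI , lift Di)

    IsI-exists : ∀ C → InI 𝓕 A B C → ∃[ i ] IsI 𝓕 A B i
    IsI-exists C (inj₁ (A∩B≠0 , _)) = let (i , Di) = Dim-exists (A ∩ B) in i , inj₁ (A∩B≠0 , lift Di)
    IsI-exists C (inj₂ (_ , _ , i , isI , _)) = i , isI

    IsI≤k : IsI 𝓕 A B i → i ≤ k
    IsI≤k isI = let (C , C∈I) = InI-witness isI in Dim-mono (B ∩ C) B (λ _ → proj₁) (InI⇒Dim C C∈I isI) DB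

    Phi⇒DirectSum : ¬ Star 𝓕 B → ∀ D → Phi k 𝓕 A B D →
                    ∃[ C ] (InI 𝓕 A B C × Lift (lsuc 0ℓ) (Trivial (C ∩ D)) × Lift (lsuc 0ℓ) (DirectSum B D (B ∩ C)))
    Phi⇒DirectSum ¬star D (inj₂ (star , _)) = contradiction star ¬star
    Phi⇒DirectSum ¬star D (inj₁ (_ , lift D⊆B , i , isI , lift DD , C , C∈I , lift D∩C≡0)) =
      C , C∈I , lift (λ v (c , d) → D∩C≡0 v (d , c)) ,
      lift (DirectSum-of-Dim B D (B ∩ C) (λ v (d , _ , c) → D∩C≡0 v (d , c)) (InI⇒Dim C C∈I isI)
              D⊆B (λ _ → proj₁) DD DB (m∸n+n≡m (IsI≤k isI)))

    DirectSum⇒Phi : ¬ Star 𝓕 B → ∀ D →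
                    ∃[ C ] (InI 𝓕 A B C × Lift (lsuc 0ℓ) (Trivial (C ∩ D)) × Lift (lsuc 0ℓ) (DirectSum B D (B ∩ C))) →
                    Phi k 𝓕 A B D
    DirectSum⇒Phi ¬star D (C , C∈I , lift C∩D≡0 , lift B≡D⊕B∩C) =
      let (i , isI) = IsI-exists C C∈I in
      inj₁ (¬star , lift D⊆B , i , isI ,
            lift (DirectSum⇒Dim B D (B ∩ C) (proj₂ B≡D⊕B∩C) (InI⇒Dim C C∈I isI) B≡D⊕B∩C DB) ,
            C , C∈I , lift (λ v (d , c) → C∩D≡0 v (c , d)))
      where
      D⊆B : D ⊆ B
      D⊆B v d = proj₂ (proj₁ B≡D⊕B∩C v) (v , 0v , d , 0∈ (B ∩ C) , sym (⊕.identityʳ v))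

    Phi⇒DirectSum-A : ¬ Star 𝓕 B → ∀ D → Phi k 𝓕 A B D →
                      (∀ C → (InI 𝓕 A B C → C ≈ A) × (C ≈ A → InI 𝓕 A B C)) → DirectSum B D (B ∩ A)
    Phi⇒DirectSum-A ¬star D φ I≡A =
      let (C , C∈I , _ , lift B≡D⊕B∩C) = Phi⇒DirectSum ¬star D φ
      in DirectSum-resp-≈ B D (B ∩ C) (B ∩ A) (∩-congˡ {C} {A} {B} (proj₁ (I≡A C) C∈I)) B≡D⊕B∩C

    IsI≤Dim-∩ : Trivial (B ∩ A) → ∀ C → C ∈F 𝓕 → ¬ Trivial (B ∩ C) →
                IsI 𝓕 A B i → Dim (B ∩ C) d → i ≤ d
    IsI≤Dim-∩ B∩A≡0 C C∈ B∩C≠0 (inj₁ (A∩B≠0 , _)) _ = contradiction (λ v (a , b) → B∩A≡0 v (b , a)) A∩B≠0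
    IsI≤Dim-∩ B∩A≡0 C C∈ B∩C≠0 (inj₂ (_ , _ , i-least)) Dd = i-least C C∈ B∩C≠0 _ Dd

    -- If B ∉ 𝓕⋆, dim (B ∩ C) ≥ i forces dim D + dim (B ∩ C) = k; if B ∈ 𝓕⋆, C meeting B forces C ≈ B and D = 0.
    Phi⇒DirectSum-meeting : Trivial (B ∩ A) → ∀ C → C ∈F 𝓕 → ¬ Trivial (B ∩ C) →
                            ∀ D → Phi k 𝓕 A B D → Trivial (C ∩ D) → DirectSum B D (B ∩ C)
    Phi⇒DirectSum-meeting B∩A≡0 C C∈ B∩C≠0 D (inj₁ (_ , lift D⊆B , i , isI , lift DD , _)) C∩D≡0
      with Dim-exists (B ∩ C)
    ... | d , DBC = DirectSum-of-Dim B D (B ∩ C) D∩B∩C≡0 DBC D⊆B (λ _ → proj₁) DD DB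
        (trans (cong (k ∸ i +_) d≡i) (m∸n+n≡m (≤-trans i≤d d≤k)))
      where
      D∩B∩C≡0 : Trivial (D ∩ (B ∩ C))
      D∩B∩C≡0 v (x , _ , c) = C∩D≡0 v (c , x)
      i≤d = IsI≤Dim-∩ B∩A≡0 C C∈ B∩C≠0 isI DBC
      d≤k = Dim-mono (B ∩ C) B (λ _ → proj₁) DBC DB
      d≡i : d ≡ i
      d≡i = ≤-antisym (+-cancelˡ-≤ (k ∸ i) d i (subst (k ∸ i + d ≤_) (sym (m∸n+n≡m (≤-trans i≤d d≤k)))
              (sum-Dim≤ B D (B ∩ C) D∩B∩C≡0 DBC D⊆B (λ _ → proj₁) DD DB)))
            i≤d
    Phi⇒DirectSum-meeting B∩A≡0 C C∈ B∩C≠0 D (inj₂ (star , lift D⊆B)) C∩D≡0 with C ≈? B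
    ... | no C≉B = contradiction (star C C∈ C≉B) B∩C≠0
    ... | yes C≈B = (λ v → decompose v , recompose v) , λ v (x∈D , _) → D≡0 v x∈D
      where
      D≡0 : Trivial D
      D≡0 v v∈D = C∩D≡0 v (proj₂ (C≈B v) (D⊆B v v∈D) , v∈D)
      decompose : ∀ v → B ∋ v → ∃[ d ] ∃[ e ] (D ∋ d × (B ∩ C) ∋ e × v ≡ d +v e)
      decompose v v∈B = 0v , v , 0∈ D , (v∈B , proj₂ (C≈B v) v∈B) , sym (⊕.identityˡ v)
      recompose : ∀ v → ∃[ d ] ∃[ e ] (D ∋ d × (B ∩ C) ∋ e × v ≡ d +v e) → B ∋ v
      recompose v (x , y , x∈D , (y∈B , _) , refl) =
        subst (λ t → B ∋ (t +v y)) (sym (D≡0 x x∈D)) (subst (B ∋_) (sym (⊕.identityˡ y)) y∈B)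

    module PhiCount (¬star : ¬ Star 𝓕 B) {i} (isI : IsI 𝓕 A B i) where

      Complementable : Subspace → Set₁
      Complementable D = ∃[ C ] (InI 𝓕 A B C × Lift (lsuc 0ℓ) (Trivial (D ∩ C)))

      -- 𝓘_A(B) is {A} if A ∩ B ≠ 0, and otherwise consists of the members of 𝓕 meeting B in dimension i.
      Complementable? : ∀ D → Dec (Complementable D)
      Complementable? D with Trivial? (A ∩ B)
      ... | no A∩B≠0 with Trivial? (D ∩ A)
      ...   | yes D∩A≡0 = yes (A , inj₁ (A∩B≠0 , lift (≈-refl {A})) , lift D∩A≡0)
      ...   | no D∩A≠0  = no λ
        { (C , inj₁ (_ , lift C≈A) , lift D∩C≡0) → D∩A≠0 (λ v (d , a) → D∩C≡0 v (d , proj₂ (C≈A v) a))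
        ; (C , inj₂ (A∩B≡0 , _) , _) → A∩B≠0 A∩B≡0 }
      Complementable? D | yes A∩B≡0 with Any.any? (λ C → Dim? (B ∩ C) i ×-dec Trivial? (D ∩ C)) 𝓕
      ... | yes found = let (C , C∈ , DBC , D∩C≡0) = find found in
        yes (C , inj₂ (A∩B≡0 , Any.map (λ { refl → ≈-refl {C} }) C∈ , i , isI , lift DBC) , lift D∩C≡0)
      ... | no none = no λ
        { (C , inj₁ (A∩B≠0 , _) , _) → A∩B≠0 A∩B≡0
        ; (C , inj₂ (_ , C∈ , j , isJ , lift Dj) , lift D∩C≡0) → none (Any.map (λ {X} C≈X →
            Dim-resp-≈ (B ∩ C) (B ∩ X) (∩-congˡ {C} {X} {B} C≈X) (subst (Dim (B ∩ C)) (IsI-unique isJ isI) Dj) ,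
            λ v (d , x) → D∩C≡0 v (d , proj₂ (C≈X v) x)) C∈) }

      Complementable-resp-≈ : ∀ D D′ → D ≈ D′ → Complementable D → Complementable D′
      Complementable-resp-≈ D D′ D≈D′ (C , C∈I , lift D∩C≡0) =
        C , C∈I , lift (λ v (d′ , c) → D∩C≡0 v (proj₂ (D≈D′ v) d′ , c))

      Phi⇔ : ∀ D → (Phi k 𝓕 A B D → D ⊆ B × Dim D (k ∸ i) × Complementable D)
                 × (D ⊆ B × Dim D (k ∸ i) × Complementable D → Phi k 𝓕 A B D)
      Phi⇔ D = (λ { (inj₂ (star , _)) → contradiction star ¬star
                  ; (inj₁ (_ , lift D⊆B , j , isJ , lift DD , D-compl)) →
                      D⊆B , subst (λ j → Dim D (k ∸ j)) (IsI-unique isJ isI) DD , D-compl })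
             , λ (D⊆B , DD , D-compl) → inj₁ (¬star , lift D⊆B , i , isI , lift DD , D-compl)

      candidates : List Subspace
      candidates = subspaces B (k ∸ i)

      #Phi : ℕ
      #Phi = count Complementable? candidates

      Phi-card : Card (Phi k 𝓕 A B) #Phi
      Phi-card = filter Complementable? candidates
               , All.zipWith (λ { {D} ((D⊆B , DD) , D-compl) → proj₂ (Phi⇔ D) (D⊆B , DD , D-compl) })
                   (Allₚ.filter⁺ Complementable? (subspaces-sound B (k ∸ i)) , Allₚ.all-filter Complementable? candidates)
               , (λ S φ → let (S⊆B , DS , S-compl) = proj₁ (Phi⇔ S) φ in
                   Any-filter⁺ Complementable? (λ {X} S≈X → Complementable-resp-≈ S X S≈X S-compl)
                     (subspaces-complete B (k ∸ i) S S⊆B DS))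
               , AllPairsₚ.filter⁺ Complementable? (subspaces-distinct B (k ∸ i))
               , refl

      private
        k≡i+[k∸i] : k ≡ i + (k ∸ i)
        k≡i+[k∸i] = sym (m+[n∸m]≡n (IsI≤k isI))

        complementary? : ∀ C D → Dec (Trivial (D ∩ (B ∩ C)))
        complementary? C D = Trivial? (D ∩ (B ∩ C))

      #complements-of-I : ∀ C → InI 𝓕 A B C → count (complementary? C) candidates ≡ q ^ (i * (k ∸ i))
      #complements-of-I C C∈I =
        #complements-Dim (B ∩ C) B (λ _ → proj₁) (InI⇒Dim C C∈I isI) (subst (Dim B) k≡i+[k∸i] DB)

      complements-Complementable : ∀ C → InI 𝓕 A B C →
                                   All (λ D → Trivial (D ∩ (B ∩ C)) → Complementable D) candidates
      complements-Complementable C C∈I = All.map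
        (λ (D⊆B , _) D∩B∩C≡0 → C , C∈I , lift (λ v (d , c) → D∩B∩C≡0 v (d , D⊆B v d , c)))
        (subspaces-sound B (k ∸ i))

      #Phi-lower : q ^ (i * (k ∸ i)) ≤ #Phi
      #Phi-lower = let (C , C∈I) = InI-witness isI in
        subst (_≤ #Phi) (#complements-of-I C C∈I)
          (count-mono (complementary? C) Complementable? (complements-Complementable C C∈I))

      -- A vector w ∈ (B ∩ C) ∖ (B ∩ C′) extends to a complement D′ of B ∩ C′ in B, which lies in φ_A(B) but is
      -- not a complement of B ∩ C.
      #Phi-strict : ∀ C C′ → InI 𝓕 A B C → InI 𝓕 A B C′ →
                    ∀ w → (B ∩ C) ∋ w → ¬ (B ∩ C′) ∋ w → q ^ (i * (k ∸ i)) < #Phi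
      #Phi-strict C C′ C∈I C′∈I w w∈B∩C w∉B∩C′ =
        let (X , X∈candidates , D′≈X) = find (subspaces-complete B (k ∸ i) D′ D′⊆B DD′) in
        subst (_< #Phi) (#complements-of-I C C∈I)
          (count-strict (complementary? C) Complementable? (complements-Complementable C C∈I) X∈candidates
            (Complementable-resp-≈ D′ X D′≈X (C′ , C′∈I , lift D′∩C′≡0))
            (λ X∩B∩C≡0 → D′∩B∩C≠0 (λ v (d′ , bc) → X∩B∩C≡0 v (proj₁ (D′≈X v) d′ , bc))))
        where
        W′ : Subspace
        W′ = B ∩ C′
        DW′ : Dim W′ i
        DW′ = InI⇒Dim C′ C′∈I isI
        w∉W′ : ¬ (W′ +⟨ [] ⟩) w
        w∉W′ ([] , w⊖0∈W′) =
          w∉B∩C′ (subst (W′ ∋_) (trans (cong (w ⊕_) ⊕-Properties.ε⁻¹≈ε) (⊕.identityʳ w)) w⊖0∈W′)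
        w-indep : IndependentIn W′ B (w ∷ [])
        w-indep = IndependentOver-∷ W′ (IndependentOver-[] W′) w∉W′ , proj₁ w∈B∩C VecAll.∷ VecAll.[]
        1≤k∸i : 1 ≤ k ∸ i
        1≤k∸i = m<n⇒0<n∸m (subst (_≤ k) (+-comm i 1)
          (+⟨⟩⊆⇒≤ W′ B (proj₁ w-indep) DW′ DB (+⟨⟩-⊆ W′ B (λ _ → proj₁) (proj₂ w-indep))))
        extension : ∃[ xs ] IndependentIn W′ B (xs ++ w ∷ [])
        extension = extend W′ B DW′ DB (k ∸ i ∸ 1) w-indep
          (≤-reflexive (trans (cong (i +_) (m∸n+n≡m 1≤k∸i)) (sym k≡i+[k∸i])))
        b : Vec V (k ∸ i ∸ 1 + 1)
        b = proj₁ extension ++ w ∷ []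
        b-indep : IndependentOver W′ b
        b-indep = proj₁ (proj₂ extension)
        D′ : Subspace
        D′ = span b
        DD′ : Dim D′ (k ∸ i)
        DD′ = subst (Dim D′) (m∸n+n≡m 1≤k∸i) (Dim-span (IndependentOver⇒Independent {W′} b-indep))
        D′⊆B : D′ ⊆ B
        D′⊆B = span-least {B} (proj₂ (proj₂ extension))
        D′∩C′≡0 : Trivial (D′ ∩ C′)
        D′∩C′≡0 v (d′ , c′) = IndependentOver⇒span-∩-trivial W′ b-indep v (d′ , D′⊆B v d′ , c′)
        D′∩B∩C≠0 : ¬ Trivial (D′ ∩ (B ∩ C))
        D′∩B∩C≠0 D′∩B∩C≡0 =
          w∉B∩C′ (subst (W′ ∋_) (sym (D′∩B∩C≡0 w (w∈D′ , w∈B∩C))) (0∈ W′))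
          where
          w∈D′ : D′ ∋ w
          w∈D′ = VecAll.head (VecAllₚ.++ʳ⁻ (proj₁ extension) (span-∋* b))

      #Phi-tight : #Phi ≡ q ^ (i * (k ∸ i)) → ∀ C C′ → InI 𝓕 A B C → InI 𝓕 A B C′ → (C ∩ B) ≈ (C′ ∩ B)
      #Phi-tight #Phi≡ C C′ C∈I C′∈I = begin
        C ∩ B  ≈⟨ ∩-comm C B ⟩
        B ∩ C  ≈⟨ ⊆-Dim⇒≈ (B ∩ C) (B ∩ C′) B∩C⊆B∩C′ (InI⇒Dim C C∈I isI) (InI⇒Dim C′ C′∈I isI) ⟩
        B ∩ C′ ≈⟨ ∩-comm B C′ ⟩
        C′ ∩ B ∎
        where
        open ≈-Reasoning
        B∩C⊆B∩C′ : (B ∩ C) ⊆ (B ∩ C′)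
        B∩C⊆B∩C′ with ⊆-or-counterexample V-enumeration (dec (B ∩ C)) (dec (B ∩ C′))
        ... | inj₁ ⊆ = ⊆
        ... | inj₂ (w , w∈ , w∉) = contradiction #Phi≡ (>⇒≢ (#Phi-strict C C′ C∈I C′∈I w w∈ w∉))

    Phi-card-Dim : Star 𝓕 B → ∀ i → Card (λ D → Phi k 𝓕 A B D × Lift (lsuc 0ℓ) (Dim D i)) (gauss q k i)
    Phi-card-Dim star i = subspaces B i
      , All.map (λ (D⊆B , DD) → inj₂ (star , lift D⊆B) , lift DD) (subspaces-sound B i)
      , (λ { S (inj₂ (_ , lift S⊆B) , lift DS) → subspaces-complete B i S S⊆B DS
           ; S (inj₁ (¬star , _) , _) → contradiction star ¬star })
      , subspaces-distinct B i
      , length-subspaces B DB i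

lemma4p2 : (𝔽 : FiniteField) (n k : ℕ) →
  let open Space 𝔽 n
      q = FiniteField.size 𝔽
  in 2 ≤ k → 2 * k ≤ n →
     (𝓕 : Family) → All (λ C → Dim C k) 𝓕 →
     (A B : Subspace) → A ∈F 𝓕 → B ∈F 𝓕 →
     -- (a)
     (¬ Star 𝓕 B → ∀ C → InI 𝓕 A B C → ∀ i → IsI 𝓕 A B i → Dim (B ∩ C) i)
     -- (b)
   × (¬ Star 𝓕 B → ∀ D →
        (Phi k 𝓕 A B D →
           ∃[ C ] (InI 𝓕 A B C × Lift (lsuc 0ℓ) (Trivial (C ∩ D)) × Lift (lsuc 0ℓ) (DirectSum B D (B ∩ C))))
      × (∃[ C ] (InI 𝓕 A B C × Lift (lsuc 0ℓ) (Trivial (C ∩ D)) × Lift (lsuc 0ℓ) (DirectSum B D (B ∩ C))) →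
           Phi k 𝓕 A B D))
   × (¬ Star 𝓕 B → ∀ D → Phi k 𝓕 A B D →
        (∀ C → (InI 𝓕 A B C → C ≈ A) × (C ≈ A → InI 𝓕 A B C)) →
        DirectSum B D (B ∩ A))
     -- (c)
   × (Trivial (B ∩ A) → ∀ C → C ∈F 𝓕 → ¬ Trivial (B ∩ C) →
        (∀ i d → IsI 𝓕 A B i → Dim (B ∩ C) d → i ≤ d)
      × (∀ D → Phi k 𝓕 A B D → Trivial (C ∩ D) → DirectSum B D (B ∩ C)))
     -- (d)
   × (¬ Star 𝓕 B → ∀ i → IsI 𝓕 A B i →
        ∃[ m ] (Card (Phi k 𝓕 A B) m
                × Lift (lsuc 0ℓ) (q ^ (i * (k ∸ i)) ≤ m)
                × (m ≡ q ^ (i * (k ∸ i)) →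
                     ∀ C C' → InI 𝓕 A B C → InI 𝓕 A B C' → Lift (lsuc 0ℓ) ((C ∩ B) ≈ (C' ∩ B)))))
     -- (e)
   × (Star 𝓕 B → ∀ i → 1 ≤ i → i < k →
        Card (λ D → Phi k 𝓕 A B D × Lift (lsuc 0ℓ) (Dim D i)) (gauss q k i)
      × q ^ (i * (k ∸ i)) < gauss q k i)
lemma4p2 𝔽 n k _ _ 𝓕 dims A B _ B∈𝓕 =
    (λ _ C C∈I _ isI → InI⇒Dim C C∈I isI)
  , (λ ¬star D → Phi⇒DirectSum ¬star D , DirectSum⇒Phi ¬star D)
  , Phi⇒DirectSum-A
  , (λ B∩A≡0 C C∈𝓕 B∩C≠0 →
       (λ _ _ → IsI≤Dim-∩ B∩A≡0 C C∈𝓕 B∩C≠0) , Phi⇒DirectSum-meeting B∩A≡0 C C∈𝓕 B∩C≠0)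
  , (λ ¬star _ isI → let open PhiCount ¬star isI in
       #Phi , Phi-card , lift #Phi-lower , λ #Phi≡ C C′ C∈I C′∈I → lift (#Phi-tight #Phi≡ C C′ C∈I C′∈I))
  , (λ star i 1≤i i<k → Phi-card-Dim star i , gauss-strict k i 1≤i i<k)
  where
  open Subspaces 𝔽 n
  open WithFamily k 𝓕 dims A B B∈𝓕
  open QArithmetic q 1<q using (gauss-strict)
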